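{- Let $\ell\ge1$. (a) The number of triangular partitions of width exactly $\ell$ and height at most $\ell$ equals $|\mathcal{B}_\ell|/2$. (b) $\left|\Delta^{\ell\times\ell}\setminus\Delta^{(\ell-1)\times(\ell-1)}\right|=I(\sigma^\ell)-I(\sigma^{\ell-1})=|\mathcal{B}_\ell|-1$.
   Context: $\mathbb{N}$ denotes the positive integers. A partition $\lambda=\lambda_1\dots\lambda_k$ is identified with its Ferrers diagram $\{(a,b)\in\mathbb{N}^2:1\le b\le k,\,1\le a\le\lambda_b\}$; its width is $\lambda_1$ and its height is $k$. A partition is triangular if there are real $r,s>0$ such that it is exactly the set of points of $\mathbb{N}^2$ on or below the line $x/r+y/s=1$ (the empty partition is triangular). $\Delta^{h\times\ell}$ is the set of triangular partitions of height at most $h$ and width at most $\ell$. $\sigma^k=(k,k-1,\dots,1)$ is the staircase partition ($\sigma^0$ is empty), and $I(\tau)$ is the number of triangular partitions contained in $\tau$. A finite binary word $w=w_1\dots w_\ell$ is balanced if for all $h\le\ell$ and all $i,j\le \ell-h+1$, $\left|\sum_{t=i}^{i+h-1}w_t-\sum_{t=j}^{j+h-1}w_t\right|\le1$; $\mathcal{B}_\ell$ is the set of balanced binary words of length $\ell$.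
   Formalization: The parameters r, s in the definition of a triangular partition range over the positive rationals instead of the positive reals. -}

module Defs where

open import Data.Nat using (ℕ; zero; suc; _≤_; _<_; _+_; ∣_-_∣)
open import Data.Bool using (Bool; true; false)
open import Data.List using (List; []; _∷_; length; take; drop; map)
open import Data.Nat.ListAction using (sum)
open import Data.List.Relation.Unary.All using (All)
open import Data.List.Relation.Unary.Linked using (Linked)
open import Data.List.Relation.Unary.Unique.Propositional using (Unique)
open import Data.List.Membership.Propositional using (_∈_)
open import Data.Empty using (⊥)
open import Data.Product using (Σ; _×_)
open import Function.Bundles using (_⇔_)
open import Data.Integer using (+_)
import Data.Rational as Q

IsPartition : List ℕ → Set
IsPartition p = All (λ x → 1 ≤ x) p × Linked (λ x y → y ≤ x) p

-- Ferrers diagram: (a , b) ∈ λ  iff  1 ≤ b ≤ k and 1 ≤ a ≤ λ_b.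
InDiagram : ℕ → ℕ → List ℕ → Set
InDiagram a zero          _        = ⊥
InDiagram a (suc _)       []       = ⊥
InDiagram a (suc zero)    (p ∷ _)  = 1 ≤ a × a ≤ p
InDiagram a (suc (suc b)) (_ ∷ ps) = InDiagram a (suc b) ps

width : List ℕ → ℕ
width []      = 0
width (p ∷ _) = p

height : List ℕ → ℕ
height = length

_⊆D_ : List ℕ → List ℕ → Set
μ ⊆D τ = ∀ a b → InDiagram a b μ → InDiagram a b τ

-- Triangular partitions.  λ is triangular iff there are r , s > 0 such
-- that λ is exactly the set of points (a , b) ∈ ℕ² (a , b ≥ 1) with
-- a / r + b / s ≤ 1, written equivalently (since r , s > 0) as
-- a·s + b·r ≤ r·s.

ℕ→ℚ : ℕ → Q.ℚ
ℕ→ℚ n = (+ n) Q./ 1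

Triangular : List ℕ → Set
Triangular p =
  Σ Q.ℚ λ r → Σ Q.ℚ λ s → (Q.0ℚ Q.< r) × (Q.0ℚ Q.< s) ×
    (∀ a b → 1 ≤ a → 1 ≤ b →
      (InDiagram a b p ⇔ ((ℕ→ℚ a Q.* s) Q.+ (ℕ→ℚ b Q.* r) Q.≤ r Q.* s)))

InΔ : ℕ → ℕ → List ℕ → Set
InΔ h l p = IsPartition p × Triangular p × height p ≤ h × width p ≤ l

staircase : ℕ → List ℕ
staircase zero    = []
staircase (suc k) = suc k ∷ staircase k

CountedByI : List ℕ → List ℕ → Set
CountedByI τ p = IsPartition p × Triangular p × p ⊆D τ

bit : Bool → ℕ
bit true  = 1
bit false = 0

window : ℕ → ℕ → List Bool → ℕ
window i h w = sum (map bit (take h (drop i w)))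

Balanced : List Bool → Set
Balanced w = ∀ h i j → h ≤ length w → i + h ≤ length w → j + h ≤ length w →
  ∣ window i h w - window j h w ∣ ≤ 1

InB : ℕ → List Bool → Set
InB l w = length w ≡ l × Balanced w
  where open import Relation.Binary.PropositionalEquality using (_≡_)

HasCard : {A : Set} → (A → Set) → ℕ → Set
HasCard {A} P n = Σ (List A) λ xs → Unique xs × (∀ x → (x ∈ xs) ⇔ P x) × length xs ≡ n
  where open import Relation.Binary.PropositionalEquality using (_≡_)

{-# OPTIONS --safe #-}

-- Write B¹ₗ for the balanced words of length l ending in 1. The suffix weights of w ∈ B¹ₗ (the number
-- of letters 1 in each suffix) form a partition of height l and width at most l. Balanced words are
-- mechanical: for the mediant Q / P of two extremal factor slopes, every factor of length m has
-- m Q / P ± 1 letters 1, and this puts the suffix-weight partition exactly under a line. Conversely,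
-- the rows of a triangular partition cut by a P + b Q ≤ B with Q ≤ P drop by at most one, and its word
-- of row drops is mechanical, hence balanced; when P < Q a triangular partition of height l and width
-- at most l is the staircase σˡ. So triangular partitions of height l and width at most l correspond
-- to B¹ₗ, and by conjugation so do those of width l and height at most l; exchanging the letters gives
-- |Bₗ| = 2 |B¹ₗ|. A partition of Δ^(l×l) outside Δ^((l-1)×(l-1)) has height l, or width l and height
-- below l; the latter correspond to B¹ₗ without 1ˡ, so there are 2 |B¹ₗ| - 1 = |Bₗ| - 1 of them.
-- Finally a triangular partition lies in σˡ exactly when it fits in the l × l box, so I(σˡ) = |Δ^(l×l)|.

module Submission where

open import Defs
open import Data.Bool using (Bool; true; false; not)
import Data.Bool.Properties as Bool
open import Data.Empty using (⊥; ⊥-elim)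
import Data.Integer as ℤ
import Data.Integer.Properties as ℤ
open import Data.List
  using (List; []; _∷_; _++_; length; map; filter; take; drop; last; replicate; applyUpTo; upTo; cartesianProduct)
import Data.List.Extrema
import Data.List.Extrema.Nat as Extremaℕ
open import Data.List.Membership.Propositional using (_∈_)
open import Data.List.Membership.Propositional.Properties
  using (∈-++⁺ʳ; ∈-++⁺ˡ; ∈-++⁻; ∈-cartesianProduct⁺; ∈-filter⁺; ∈-filter⁻; ∈-map⁺; ∈-map⁻; ∈-upTo⁺; ∈-upTo⁻)
open import Data.List.Properties
  using (drop-all; drop-drop; drop-map; last-map; length-++; length-applyUpTo; length-drop; length-map; length-replicate;
         length-take; map-++; take++drop≡id; take-all; take-map; ∷-injective)
import Data.List.Properties as List
open import Data.List.Relation.Unary.All as All using (All; []; _∷_)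
import Data.List.Relation.Unary.All.Properties as Allₚ
open import Data.List.Relation.Unary.AllPairs using ([]; _∷_)
open import Data.List.Relation.Unary.Any using (here; there)
open import Data.List.Relation.Unary.Linked as Linked using (Linked; []; [-]; _∷_)
open import Data.List.Relation.Unary.Unique.Propositional using (Unique)
import Data.List.Relation.Unary.Unique.Propositional.Properties as Unique
open import Data.Maybe as Maybe using (just; nothing)
import Data.Maybe.Properties as Maybeₚ
open import Data.Nat using (ℕ; zero; suc; _≤_; _<_; _+_; _*_; _∸_; _^_; _⊓_; z≤n; s≤s; _≟_; _≤?_; _<?_; _<ᵇ_; ∣_-_∣)
open import Data.Nat.ListAction using (sum)
open import Data.Nat.ListAction.Properties using (sum-++)
open import Data.Nat.Properties
open import Data.Nat.Tactic.RingSolver using (solve-∀)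
open import Data.Product using (Σ; _×_; _,_; proj₁; proj₂)
open import Data.Rational as ℚ using (ℚ; mkℚ)
import Data.Rational.Properties as ℚ
open import Data.Rational.Unnormalised as ℚᵘ using (ℚᵘ; mkℚᵘ; _≃_)
import Data.Rational.Unnormalised.Properties as ℚᵘ
open import Data.Sum as Sum using (_⊎_; inj₁; inj₂; [_,_])
open import Function.Base using (_∘_)
open import Function.Bundles using (_⇔_; mk⇔; Equivalence)
import Function.Properties.Equivalence as ⇔
open import Relation.Binary.Definitions using (tri<; tri≈; tri>)
open import Relation.Binary.PropositionalEquality hiding ([_])
open import Relation.Nullary using (¬_; Dec; yes; no)
open import Relation.Nullary.Decidable using (_×-dec_; _→-dec_; map′)
open import Relation.Unary using (Decidable)
open import Relation.Unary.Properties using (∁?)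

open Equivalence using (to; from)

-- Rows and conjugation of partitions

row : List ℕ → ℕ → ℕ
row []       _       = 0
row (x ∷ _)  zero    = x
row (_ ∷ xs) (suc j) = row xs j

inDiagram⇔≤row : ∀ a j p → InDiagram a (suc j) p ⇔ (1 ≤ a × a ≤ row p j)
inDiagram⇔≤row a j       []      = mk⇔ (λ ()) (λ (1≤a , a≤0) → ⊥-elim (n≮0 (≤-trans 1≤a a≤0)))
inDiagram⇔≤row a zero    (x ∷ p) = mk⇔ (λ d → d) (λ d → d)
inDiagram⇔≤row a (suc j) (x ∷ p) = inDiagram⇔≤row a j p

¬inDiagram-0 : ∀ b p → ¬ InDiagram 0 b p
¬inDiagram-0 zero    p ()
¬inDiagram-0 (suc j) p d with to (inDiagram⇔≤row 0 j p) d
... | () , _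

width≡row0 : ∀ p → width p ≡ row p 0
width≡row0 []      = refl
width≡row0 (x ∷ p) = refl

row-≥length : ∀ p {j} → length p ≤ j → row p j ≡ 0
row-≥length []      _         = refl
row-≥length (x ∷ p) (s≤s len≤j) = row-≥length p len≤j

isPartition-tail : ∀ {x p} → IsPartition (x ∷ p) → IsPartition p
isPartition-tail (_ ∷ pos , dec) = pos , Linked.tail dec

row-positive : ∀ {p} → IsPartition p → ∀ {j} → j < length p → 1 ≤ row p j
row-positive {x ∷ p} (1≤x ∷ _ , _) {zero}  _           = 1≤x
row-positive {x ∷ p} part          {suc j} (s≤s j<len) = row-positive (isPartition-tail part) j<len

row-suc-≤ : ∀ {p} → IsPartition p → ∀ j → row p (suc j) ≤ row p j
row-suc-≤ {[]}         _              j       = z≤n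
row-suc-≤ {x ∷ []}     _              zero    = z≤n
row-suc-≤ {x ∷ y ∷ p}  (_ , y≤x ∷ _)  zero    = y≤x
row-suc-≤ {x ∷ p}      part           (suc j) = row-suc-≤ (isPartition-tail part) j

row-antitone : ∀ {p} → IsPartition p → ∀ {j k} → j ≤ k → row p k ≤ row p j
row-antitone part {k = zero}  z≤n   = ≤-refl
row-antitone part {k = suc k} j≤1+k with m≤n⇒m<n∨m≡n j≤1+k
... | inj₁ (s≤s j≤k) = ≤-trans (row-suc-≤ part k) (row-antitone part j≤k)
... | inj₂ refl      = ≤-refl

isPartition-fromRows : ∀ q → (∀ j → j < length q → 1 ≤ row q j) → (∀ j → row q (suc j) ≤ row q j) → IsPartition q
isPartition-fromRows []          _   _   = [] , []
isPartition-fromRows (x ∷ [])    pos _   = pos 0 (s≤s z≤n) ∷ [] , [-]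
isPartition-fromRows (x ∷ y ∷ q) pos dec
  with isPartition-fromRows (y ∷ q) (λ j j<len → pos (suc j) (s≤s j<len)) (λ j → dec (suc j))
... | pos′ , dec′ = pos 0 (s≤s z≤n) ∷ pos′ , dec 0 ∷ dec′

rows-injective : ∀ {p q} → IsPartition p → IsPartition q → (∀ j → row p j ≡ row q j) → p ≡ q
rows-injective {[]}    {[]}    _     _     _   = refl
rows-injective {[]}    {y ∷ q} _     (1≤y ∷ _ , _) eq = ⊥-elim (<⇒≱ 1≤y (≤-reflexive (sym (eq 0))))
rows-injective {x ∷ p} {[]}    (1≤x ∷ _ , _) _ eq = ⊥-elim (<⇒≱ 1≤x (≤-reflexive (eq 0)))
rows-injective {x ∷ p} {y ∷ q} pp    pq    eq  =
  cong₂ _∷_ (eq 0) (rows-injective (isPartition-tail pp) (isPartition-tail pq) (λ j → eq (suc j)))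

positive-lowerSets-injective : ∀ {x y} → (∀ a → 1 ≤ a → a ≤ x ⇔ a ≤ y) → x ≡ y
positive-lowerSets-injective {zero}  {zero}  _  = refl
positive-lowerSets-injective {zero}  {suc y} eq = ⊥-elim (<⇒≱ (s≤s z≤n) (from (eq (suc y) (s≤s z≤n)) ≤-refl))
positive-lowerSets-injective {suc x} {zero}  eq = ⊥-elim (<⇒≱ (s≤s z≤n) (to (eq (suc x) (s≤s z≤n)) ≤-refl))
positive-lowerSets-injective {suc x} {suc y} eq =
  ≤-antisym (to (eq (suc x) (s≤s z≤n)) ≤-refl) (from (eq (suc y) (s≤s z≤n)) ≤-refl)

diagrams-injective : ∀ {p q} → IsPartition p → IsPartition q → (∀ a b → InDiagram a b p ⇔ InDiagram a b q) → p ≡ q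
diagrams-injective {p} {q} pp pq same = rows-injective pp pq λ j → positive-lowerSets-injective λ a 1≤a →
  mk⇔ (λ a≤p → proj₂ (to (inDiagram⇔≤row a j q) (to (same a (suc j)) (from (inDiagram⇔≤row a j p) (1≤a , a≤p)))))
      (λ a≤q → proj₂ (to (inDiagram⇔≤row a j p) (from (same a (suc j)) (from (inDiagram⇔≤row a j q) (1≤a , a≤q)))))

#parts≥ : ℕ → List ℕ → ℕ
#parts≥ t []      = 0
#parts≥ t (x ∷ p) with t ≤? x
... | yes _ = suc (#parts≥ t p)
... | no  _ = #parts≥ t p

#parts≥-antitone : ∀ p {t t′} → t ≤ t′ → #parts≥ t′ p ≤ #parts≥ t p
#parts≥-antitone []      t≤t′ = z≤n
#parts≥-antitone (x ∷ p) {t} {t′} t≤t′ with t ≤? x | t′ ≤? x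
... | yes _   | yes _    = s≤s (#parts≥-antitone p t≤t′)
... | yes _   | no  _    = m≤n⇒m≤1+n (#parts≥-antitone p t≤t′)
... | no  t≰x | yes t′≤x = ⊥-elim (t≰x (≤-trans t≤t′ t′≤x))
... | no  _   | no  _    = #parts≥-antitone p t≤t′

#parts≥-aboveWidth : ∀ {p} → IsPartition p → ∀ {t} → row p 0 < t → #parts≥ t p ≡ 0
#parts≥-aboveWidth {[]}    _    _     = refl
#parts≥-aboveWidth {x ∷ p} part {t} x<t with t ≤? x
... | yes t≤x = ⊥-elim (<⇒≱ x<t t≤x)
... | no  _   = #parts≥-aboveWidth (isPartition-tail part) (≤-<-trans (row-suc-≤ part 0) x<t)

#parts≥-length : ∀ {p} → IsPartition p → #parts≥ 1 p ≡ length p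
#parts≥-length {[]}    _    = refl
#parts≥-length {x ∷ p} part with 1 ≤? x
... | yes _   = cong suc (#parts≥-length (isPartition-tail part))
... | no  1≰x = ⊥-elim (1≰x (row-positive part (s≤s z≤n)))

<#parts≥⇔≤row : ∀ {p} → IsPartition p → ∀ {t} → 1 ≤ t → ∀ a → (a < #parts≥ t p) ⇔ (t ≤ row p a)
<#parts≥⇔≤row {[]}    _    1≤t a = mk⇔ (λ ()) (λ t≤0 → ⊥-elim (n≮0 (≤-trans 1≤t t≤0)))
<#parts≥⇔≤row {x ∷ p} part {t} 1≤t a with t ≤? x
<#parts≥⇔≤row {x ∷ p} part 1≤t zero    | yes t≤x = mk⇔ (λ _ → t≤x) (λ _ → s≤s z≤n)
<#parts≥⇔≤row {x ∷ p} part 1≤t (suc a) | yes _   =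
  mk⇔ (λ a<# → to (<#parts≥⇔≤row (isPartition-tail part) 1≤t a) (≤-pred a<#))
      (λ t≤row → s≤s (from (<#parts≥⇔≤row (isPartition-tail part) 1≤t a) t≤row))
<#parts≥⇔≤row {x ∷ p} part 1≤t a       | no  t≰x =
  mk⇔ (λ a<# → ⊥-elim (<⇒≱ (≤-trans (s≤s z≤n) a<#) (≤-reflexive (#parts≥-aboveWidth (isPartition-tail part)
                                                   (≤-<-trans (row-suc-≤ part 0) (≰⇒> t≰x))))))
      (λ t≤row → ⊥-elim (t≰x (≤-trans t≤row (row-antitone part {k = a} z≤n))))

row-applyUpTo-< : ∀ (f : ℕ → ℕ) {n i} → i < n → row (applyUpTo f n) i ≡ f i
row-applyUpTo-< f {suc n} {zero}  _         = refl
row-applyUpTo-< f {suc n} {suc i} (s≤s i<n) = row-applyUpTo-< (λ i → f (suc i)) i<n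

row-applyUpTo-≥ : ∀ (f : ℕ → ℕ) {n i} → n ≤ i → row (applyUpTo f n) i ≡ 0
row-applyUpTo-≥ f {n} n≤i = row-≥length (applyUpTo f n) (subst (_≤ _) (sym (length-applyUpTo f n)) n≤i)

conj : List ℕ → List ℕ
conj p = applyUpTo (λ i → #parts≥ (suc i) p) (width p)

length-conj : ∀ p → length (conj p) ≡ width p
length-conj p = length-applyUpTo (λ i → #parts≥ (suc i) p) (width p)

row-conj : ∀ {p} → IsPartition p → ∀ i → row (conj p) i ≡ #parts≥ (suc i) p
row-conj {p} part i with i <? width p
... | yes i<w = row-applyUpTo-< (λ i → #parts≥ (suc i) p) i<w
... | no  i≮w = trans (row-applyUpTo-≥ (λ i → #parts≥ (suc i) p) (≮⇒≥ i≮w))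
                      (sym (#parts≥-aboveWidth part (s≤s (subst (_≤ i) (width≡row0 p) (≮⇒≥ i≮w)))))

width-conj : ∀ {p} → IsPartition p → width (conj p) ≡ length p
width-conj {p} part = trans (width≡row0 (conj p)) (trans (row-conj part 0) (#parts≥-length part))

isPartition-conj : ∀ {p} → IsPartition p → IsPartition (conj p)
isPartition-conj {p} part = isPartition-fromRows (conj p)
  (λ j j<len → subst (1 ≤_) (sym (row-conj part j))
     (from (<#parts≥⇔≤row part (s≤s z≤n) 0) (subst (suc j ≤_) (width≡row0 p) (subst (j <_) (length-conj p) j<len))))
  (λ j → subst₂ _≤_ (sym (row-conj part (suc j))) (sym (row-conj part j)) (#parts≥-antitone p (n≤1+n (suc j))))

inDiagram-conj : ∀ {p} → IsPartition p → ∀ a b → InDiagram a b (conj p) ⇔ InDiagram b a p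
inDiagram-conj part a       zero    = mk⇔ (λ ()) (λ d → ⊥-elim (¬inDiagram-0 a _ d))
inDiagram-conj {p} part zero (suc i) = mk⇔ (λ d → ⊥-elim (¬inDiagram-0 (suc i) (conj p) d)) (λ ())
inDiagram-conj {p} part (suc a) (suc i) =
  mk⇔ (λ d → from (inDiagram⇔≤row (suc i) a p) (s≤s z≤n , to (<#parts≥⇔≤row part (s≤s z≤n) a)
               (subst (suc a ≤_) (row-conj part i) (proj₂ (to (inDiagram⇔≤row (suc a) i (conj p)) d)))))
      (λ d → from (inDiagram⇔≤row (suc a) i (conj p)) (s≤s z≤n , subst (suc a ≤_) (sym (row-conj part i))
               (from (<#parts≥⇔≤row part (s≤s z≤n) a) (proj₂ (to (inDiagram⇔≤row (suc i) a p) d)))))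

conj-involutive : ∀ {p} → IsPartition p → conj (conj p) ≡ p
conj-involutive {p} part = diagrams-injective (isPartition-conj (isPartition-conj part)) part λ a b →
  mk⇔ (λ d → to (inDiagram-conj part b a) (to (inDiagram-conj (isPartition-conj part) a b) d))
      (λ d → from (inDiagram-conj (isPartition-conj part) a b) (from (inDiagram-conj part b a) d))

row-staircase : ∀ l j → row (staircase l) j ≡ l ∸ j
row-staircase zero    zero    = refl
row-staircase zero    (suc j) = refl
row-staircase (suc l) zero    = refl
row-staircase (suc l) (suc j) = row-staircase l j

length-staircase : ∀ l → length (staircase l) ≡ l
length-staircase zero    = refl
length-staircase (suc l) = cong suc (length-staircase l)

isPartition-staircase : ∀ l → IsPartition (staircase l)
isPartition-staircase l = isPartition-fromRows (staircase l)
  (λ j j<len → subst (1 ≤_) (sym (row-staircase l j)) (m<n⇒0<n∸m (subst (j <_) (length-staircase l) j<len)))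
  (λ j → subst₂ _≤_ (sym (row-staircase l (suc j))) (sym (row-staircase l j)) (∸-monoʳ-≤ l (n≤1+n j)))

-- Triangularity with natural coefficients

CutBy : ℕ → ℕ → ℕ → List ℕ → Set
CutBy P Q B p = ∀ a b → 1 ≤ a → 1 ≤ b → InDiagram a b p ⇔ (a * P + b * Q ≤ B)

Triangularℕ : List ℕ → Set
Triangularℕ p = Σ ℕ λ P → Σ ℕ λ Q → Σ ℕ λ B → 1 ≤ P × 1 ≤ Q × 1 ≤ B × CutBy P Q B p

cutBy-row : ∀ {P Q B p} → CutBy P Q B p → ∀ a j → 1 ≤ a → a ≤ row p j ⇔ (a * P + suc j * Q ≤ B)
cutBy-row {p = p} cut a j 1≤a = mk⇔
  (λ a≤ → to (cut a (suc j) 1≤a (s≤s z≤n)) (from (inDiagram⇔≤row a j p) (1≤a , a≤)))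
  (λ below → proj₂ (to (inDiagram⇔≤row a j p) (from (cut a (suc j) 1≤a (s≤s z≤n)) below)))

cutBy-fromRows : ∀ {P Q B p} → (∀ a j → 1 ≤ a → a ≤ row p j ⇔ (a * P + suc j * Q ≤ B)) → CutBy P Q B p
cutBy-fromRows {p = p} rows a (suc j) 1≤a _ = mk⇔
  (λ d → to (rows a j 1≤a) (proj₂ (to (inDiagram⇔≤row a j p) d)))
  (λ below → from (inDiagram⇔≤row a j p) (1≤a , from (rows a j 1≤a) below))

ℤ-+≤+⇔ : ∀ {m n} → ℤ.+ m ℤ.≤ ℤ.+ n ⇔ m ≤ n
ℤ-+≤+⇔ = mk⇔ ℤ.drop‿+≤+ ℤ.+≤+

Line : ℚ → ℚ → ℕ → ℕ → Set
Line r s a b = (ℕ→ℚ a ℚ.* s) ℚ.+ (ℕ→ℚ b ℚ.* r) ℚ.≤ r ℚ.* s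

Lineᵘ : ℚᵘ → ℚᵘ → ℕ → ℕ → Set
Lineᵘ r s a b = (mkℚᵘ (ℤ.+ a) 0 ℚᵘ.* s) ℚᵘ.+ (mkℚᵘ (ℤ.+ b) 0 ℚᵘ.* r) ℚᵘ.≤ r ℚᵘ.* s

line⇔lineᵘ : ∀ {r s r′ s′} a b → ℚ.toℚᵘ r ≃ r′ → ℚ.toℚᵘ s ≃ s′ → Line r s a b ⇔ Lineᵘ r′ s′ a b
line⇔lineᵘ {r} {s} {r′} {s′} a b r≃ s≃ = mk⇔
  (λ le → ℚᵘ.≤-respʳ-≃ rhs≃ (ℚᵘ.≤-respˡ-≃ lhs≃ (ℚ.toℚᵘ-mono-≤ le)))
  (λ le → ℚ.toℚᵘ-cancel-≤ (ℚᵘ.≤-respʳ-≃ (ℚᵘ.≃-sym rhs≃) (ℚᵘ.≤-respˡ-≃ (ℚᵘ.≃-sym lhs≃) le)))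
  where
  toℚᵘ-ℕ→ℚ : ∀ a → ℚ.toℚᵘ (ℕ→ℚ a) ≃ mkℚᵘ (ℤ.+ a) 0
  toℚᵘ-ℕ→ℚ a = ℚ.toℚᵘ-fromℚᵘ (mkℚᵘ (ℤ.+ a) 0)
  lhs≃ : ℚ.toℚᵘ ((ℕ→ℚ a ℚ.* s) ℚ.+ (ℕ→ℚ b ℚ.* r)) ≃ (mkℚᵘ (ℤ.+ a) 0 ℚᵘ.* s′) ℚᵘ.+ (mkℚᵘ (ℤ.+ b) 0 ℚᵘ.* r′)
  lhs≃ = ℚᵘ.≃-trans (ℚ.toℚᵘ-homo-+ (ℕ→ℚ a ℚ.* s) (ℕ→ℚ b ℚ.* r)) (ℚᵘ.+-cong
           (ℚᵘ.≃-trans (ℚ.toℚᵘ-homo-* (ℕ→ℚ a) s) (ℚᵘ.*-cong (toℚᵘ-ℕ→ℚ a) s≃))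
           (ℚᵘ.≃-trans (ℚ.toℚᵘ-homo-* (ℕ→ℚ b) r) (ℚᵘ.*-cong (toℚᵘ-ℕ→ℚ b) r≃)))
  rhs≃ : ℚ.toℚᵘ (r ℚ.* s) ≃ r′ ℚᵘ.* s′
  rhs≃ = ℚᵘ.≃-trans (ℚ.toℚᵘ-homo-* r s) (ℚᵘ.*-cong r≃ s≃)

-- With r = R / (1 + dr) and s = S / (1 + ds) both sides of Lineᵘ have denominator (1 + dr) (1 + ds).
lineᵘ⇔ : ∀ R dr S ds a b → Lineᵘ (mkℚᵘ (ℤ.+ R) dr) (mkℚᵘ (ℤ.+ S) ds) a b ⇔ (a * S * suc dr + b * R * suc ds ≤ R * S)
lineᵘ⇔ R dr S ds a b = mk⇔
  (λ { (ℚᵘ.*≤* le) → subst (_≤ R * S) N≡ (*-cancelʳ-≤ N (R * S) K (to ℤ-+≤+⇔ (subst₂ ℤ._≤_ ↥lhs↧rhs ↥rhs↧lhs le))) })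
  (λ le → ℚᵘ.*≤* (subst₂ ℤ._≤_ (sym ↥lhs↧rhs) (sym ↥rhs↧lhs) (from ℤ-+≤+⇔ (*-monoˡ-≤ K (subst (_≤ R * S) (sym N≡) le)))))
  where
  N = a * S * (1 * suc dr) + b * R * (1 * suc ds)
  K = suc dr * suc ds

  N≡ : N ≡ a * S * suc dr + b * R * suc ds
  N≡ = cong₂ _+_ (cong (a * S *_) (*-identityˡ (suc dr))) (cong (b * R *_) (*-identityˡ (suc ds)))

  ↥lhs↧rhs : ((ℤ.+ a ℤ.* ℤ.+ S) ℤ.* ℤ.+ (1 * suc dr) ℤ.+ (ℤ.+ b ℤ.* ℤ.+ R) ℤ.* ℤ.+ (1 * suc ds)) ℤ.* ℤ.+ K ≡ ℤ.+ (N * K)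
  ↥lhs↧rhs = begin
    ((ℤ.+ a ℤ.* ℤ.+ S) ℤ.* ℤ.+ (1 * suc dr) ℤ.+ (ℤ.+ b ℤ.* ℤ.+ R) ℤ.* ℤ.+ (1 * suc ds)) ℤ.* ℤ.+ K
      ≡⟨ cong₂ (λ x y → (x ℤ.* ℤ.+ (1 * suc dr) ℤ.+ y ℤ.* ℤ.+ (1 * suc ds)) ℤ.* ℤ.+ K) (sym (ℤ.pos-* a S)) (sym (ℤ.pos-* b R)) ⟩
    (ℤ.+ (a * S) ℤ.* ℤ.+ (1 * suc dr) ℤ.+ ℤ.+ (b * R) ℤ.* ℤ.+ (1 * suc ds)) ℤ.* ℤ.+ K
      ≡⟨ cong₂ (λ x y → (x ℤ.+ y) ℤ.* ℤ.+ K) (sym (ℤ.pos-* (a * S) (1 * suc dr))) (sym (ℤ.pos-* (b * R) (1 * suc ds))) ⟩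
    (ℤ.+ (a * S * (1 * suc dr)) ℤ.+ ℤ.+ (b * R * (1 * suc ds))) ℤ.* ℤ.+ K
      ≡⟨ cong (ℤ._* ℤ.+ K) (sym (ℤ.pos-+ (a * S * (1 * suc dr)) (b * R * (1 * suc ds)))) ⟩
    ℤ.+ N ℤ.* ℤ.+ K
      ≡⟨ sym (ℤ.pos-* N K) ⟩
    ℤ.+ (N * K) ∎
    where open ≡-Reasoning

  ↥rhs↧lhs : (ℤ.+ R ℤ.* ℤ.+ S) ℤ.* ℤ.+ ((1 * suc ds) * (1 * suc dr)) ≡ ℤ.+ (R * S * K)
  ↥rhs↧lhs = begin
    (ℤ.+ R ℤ.* ℤ.+ S) ℤ.* ℤ.+ ((1 * suc ds) * (1 * suc dr))
      ≡⟨ cong (ℤ._* ℤ.+ ((1 * suc ds) * (1 * suc dr))) (sym (ℤ.pos-* R S)) ⟩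
    ℤ.+ (R * S) ℤ.* ℤ.+ ((1 * suc ds) * (1 * suc dr))
      ≡⟨ sym (ℤ.pos-* (R * S) _) ⟩
    ℤ.+ (R * S * ((1 * suc ds) * (1 * suc dr)))
      ≡⟨ cong (λ x → ℤ.+ (R * S * x)) (denominators dr ds) ⟩
    ℤ.+ (R * S * K) ∎
    where
    open ≡-Reasoning
    denominators : ∀ dr ds → (1 * suc ds) * (1 * suc dr) ≡ suc dr * suc ds
    denominators = solve-∀

triangularℕ⇒triangular : ∀ {p} → Triangularℕ p → Triangular p
triangularℕ⇒triangular (suc P′ , suc Q′ , suc B′ , _ , _ , _ , cut) =
  r , s , 0<r , 0<s , λ a b 1≤a 1≤b → line a b (cut a b 1≤a 1≤b)
  where
  P = suc P′
  Q = suc Q′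
  B = suc B′
  r = (ℤ.+ B) ℚ./ P
  s = (ℤ.+ B) ℚ./ Q
  r≃ : ℚ.toℚᵘ r ≃ mkℚᵘ (ℤ.+ B) P′
  r≃ = ℚ.toℚᵘ-fromℚᵘ (mkℚᵘ (ℤ.+ B) P′)
  s≃ : ℚ.toℚᵘ s ≃ mkℚᵘ (ℤ.+ B) Q′
  s≃ = ℚ.toℚᵘ-fromℚᵘ (mkℚᵘ (ℤ.+ B) Q′)
  0<r : ℚ.0ℚ ℚ.< r
  0<r = ℚ.toℚᵘ-cancel-< (ℚᵘ.<-respʳ-≃ (ℚᵘ.≃-sym r≃) (ℚᵘ.*<* (ℤ.+<+ (s≤s z≤n))))
  0<s : ℚ.0ℚ ℚ.< s
  0<s = ℚ.toℚᵘ-cancel-< (ℚᵘ.<-respʳ-≃ (ℚᵘ.≃-sym s≃) (ℚᵘ.*<* (ℤ.+<+ (s≤s z≤n))))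
  scale : ∀ a b → a * B * P + b * B * Q ≡ (a * P + b * Q) * B
  scale a b = factor a b B P Q
    where
    factor : ∀ a b B P Q → a * B * P + b * B * Q ≡ (a * P + b * Q) * B
    factor = solve-∀
  line⇔ : ∀ a b → Line r s a b ⇔ (a * P + b * Q ≤ B)
  line⇔ a b = mk⇔
    (λ l → *-cancelʳ-≤ _ _ B (subst (_≤ B * B) (scale a b) (to (lineᵘ⇔ B P′ B Q′ a b) (to (line⇔lineᵘ a b r≃ s≃) l))))
    (λ le → from (line⇔lineᵘ a b r≃ s≃) (from (lineᵘ⇔ B P′ B Q′ a b) (subst (_≤ B * B) (sym (scale a b)) (*-monoˡ-≤ B le))))
  line : ∀ a b → InDiagram a b _ ⇔ (a * P + b * Q ≤ B) → InDiagram a b _ ⇔ Line r s a b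
  line a b d⇔ = mk⇔ (λ d → from (line⇔ a b) (to d⇔ d)) (λ l → from d⇔ (to (line⇔ a b) l))

triangular⇒triangularℕ : ∀ {p} → Triangular p → Triangularℕ p
triangular⇒triangularℕ (mkℚ (ℤ.+ zero)   _ _ , _ , ℚ.*<* (ℤ.+<+ ()) , _ , _)
triangular⇒triangularℕ (mkℚ ℤ.-[1+ _ ]   _ _ , _ , ℚ.*<* () , _ , _)
triangular⇒triangularℕ (mkℚ ℤ.+[1+ _ ]   _ _ , mkℚ (ℤ.+ zero) _ _ , _ , ℚ.*<* (ℤ.+<+ ()) , _)
triangular⇒triangularℕ (mkℚ ℤ.+[1+ _ ]   _ _ , mkℚ ℤ.-[1+ _ ] _ _ , _ , ℚ.*<* () , _)
triangular⇒triangularℕ (r@(mkℚ ℤ.+[1+ R′ ] dr _) , s@(mkℚ ℤ.+[1+ S′ ] ds _) , _ , _ , tri) =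
  S * suc dr , R * suc ds , R * S , s≤s z≤n , s≤s z≤n , s≤s z≤n , λ a b 1≤a 1≤b →
    mk⇔ (λ d → subst (_≤ R * S) (sym (assoc a b)) (to (line⇔ a b) (to (tri a b 1≤a 1≤b) d)))
        (λ le → from (tri a b 1≤a 1≤b) (from (line⇔ a b) (subst (_≤ R * S) (assoc a b) le)))
  where
  R = suc R′
  S = suc S′
  line⇔ : ∀ a b → Line r s a b ⇔ (a * S * suc dr + b * R * suc ds ≤ R * S)
  line⇔ a b = mk⇔ (λ l → to (lineᵘ⇔ R dr S ds a b) (to (line⇔lineᵘ a b ℚᵘ.≃-refl ℚᵘ.≃-refl) l))
                  (λ le → from (line⇔lineᵘ a b ℚᵘ.≃-refl ℚᵘ.≃-refl) (from (lineᵘ⇔ R dr S ds a b) le))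
  assoc : ∀ a b → a * (S * suc dr) + b * (R * suc ds) ≡ a * S * suc dr + b * R * suc ds
  assoc a b = cong₂ _+_ (sym (*-assoc a S (suc dr))) (sym (*-assoc b R (suc ds)))

-- Weights of binary words

weight : List Bool → ℕ
weight w = sum (map bit w)

weight-++ : ∀ u v → weight (u ++ v) ≡ weight u + weight v
weight-++ u v = trans (cong sum (map-++ bit u v)) (sum-++ (map bit u) (map bit v))

weight≤length : ∀ w → weight w ≤ length w
weight≤length []          = z≤n
weight≤length (true ∷ w)  = s≤s (weight≤length w)
weight≤length (false ∷ w) = m≤n⇒m≤1+n (weight≤length w)

suffixWeight : List Bool → ℕ → ℕ
suffixWeight w j = weight (drop j w)

suffixWeight-≥length : ∀ w {j} → length w ≤ j → suffixWeight w j ≡ 0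
suffixWeight-≥length w {j} len≤j = cong weight (drop-all j w len≤j)

window+suffixWeight : ∀ w i m → window i m w + suffixWeight w (i + m) ≡ suffixWeight w i
window+suffixWeight w i m = begin
  window i m w + suffixWeight w (i + m)       ≡⟨ cong (λ v → window i m w + weight v) (sym (drop-drop i m w)) ⟩
  window i m w + weight (drop m (drop i w))   ≡⟨ sym (weight-++ (take m (drop i w)) (drop m (drop i w))) ⟩
  weight (take m (drop i w) ++ drop m (drop i w)) ≡⟨ cong weight (take++drop≡id m (drop i w)) ⟩
  suffixWeight w i                            ∎
  where open ≡-Reasoning

window-+ : ∀ w i a b → window i (a + b) w ≡ window i a w + window (i + a) b w
window-+ w i a b = +-cancelʳ-≡ (suffixWeight w (i + (a + b))) _ _ (begin
  window i (a + b) w + suffixWeight w (i + (a + b))                 ≡⟨ window+suffixWeight w i (a + b) ⟩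
  suffixWeight w i                                                  ≡⟨ sym (window+suffixWeight w i a) ⟩
  window i a w + suffixWeight w (i + a)                             ≡⟨ cong (window i a w +_) (sym (split (i + a))) ⟩
  window i a w + (window (i + a) b w + suffixWeight w (i + a + b))  ≡⟨ sym (+-assoc (window i a w) _ _) ⟩
  window i a w + window (i + a) b w + suffixWeight w (i + a + b)    ≡⟨ cong (λ k → W + suffixWeight w k) (+-assoc i a b) ⟩
  window i a w + window (i + a) b w + suffixWeight w (i + (a + b))  ∎)
  where
  open ≡-Reasoning
  W = window i a w + window (i + a) b w
  split : ∀ k → window k b w + suffixWeight w (k + b) ≡ suffixWeight w k
  split k = window+suffixWeight w k b

suffixWeights : List Bool → List ℕ
suffixWeights []       = []
suffixWeights (x ∷ xs) = weight (x ∷ xs) ∷ suffixWeights xs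

length-suffixWeights : ∀ w → length (suffixWeights w) ≡ length w
length-suffixWeights []      = refl
length-suffixWeights (x ∷ w) = cong suc (length-suffixWeights w)

width-suffixWeights : ∀ w → width (suffixWeights w) ≡ weight w
width-suffixWeights []      = refl
width-suffixWeights (x ∷ w) = refl

row-suffixWeights : ∀ w j → row (suffixWeights w) j ≡ suffixWeight w j
row-suffixWeights []      zero    = refl
row-suffixWeights []      (suc j) = refl
row-suffixWeights (x ∷ w) zero    = refl
row-suffixWeights (x ∷ w) (suc j) = row-suffixWeights w j

suffixWeights-injective : ∀ {u v} → suffixWeights u ≡ suffixWeights v → u ≡ v
suffixWeights-injective {[]}    {[]}    _  = refl
suffixWeights-injective {x ∷ u} {y ∷ v} eq with suffixWeights-injective {u} {v} (proj₂ (∷-injective eq))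
... | refl = cong (_∷ u) (bit-injective (+-cancelʳ-≡ (weight u) (bit x) (bit y) (proj₁ (∷-injective eq))))
  where
  bit-injective : ∀ {x y} → bit x ≡ bit y → x ≡ y
  bit-injective {true}  {true}  _ = refl
  bit-injective {false} {false} _ = refl

suffixWeight-positive : ∀ {w} → last w ≡ just true → ∀ {j} → j < length w → 1 ≤ suffixWeight w j
suffixWeight-positive {x ∷ []}    refl {zero}  _           = s≤s z≤n
suffixWeight-positive {x ∷ []}    refl {suc j} (s≤s ())
suffixWeight-positive {x ∷ y ∷ w} ends {zero}  _           =
  ≤-trans (suffixWeight-positive {y ∷ w} ends {0} (s≤s z≤n)) (m≤n+m _ (bit x))
suffixWeight-positive {x ∷ y ∷ w} ends {suc j} (s≤s j<len) = suffixWeight-positive ends j<len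

weight-positive : ∀ w → last w ≡ just true → 1 ≤ weight w
weight-positive w@(_ ∷ _) ends = suffixWeight-positive {w} ends {0} (s≤s z≤n)

suffixWeight-suc-≤ : ∀ w j → suffixWeight w (suc j) ≤ suffixWeight w j
suffixWeight-suc-≤ []      j       = z≤n
suffixWeight-suc-≤ (x ∷ w) zero    = m≤n+m (weight w) (bit x)
suffixWeight-suc-≤ (x ∷ w) (suc j) = suffixWeight-suc-≤ w j

isPartition-suffixWeights : ∀ {w} → last w ≡ just true → IsPartition (suffixWeights w)
isPartition-suffixWeights {w} ends = isPartition-fromRows (suffixWeights w)
  (λ j j<len → subst (1 ≤_) (sym (row-suffixWeights w j))
                 (suffixWeight-positive ends (subst (j <_) (length-suffixWeights w) j<len)))
  (λ j → subst₂ _≤_ (sym (row-suffixWeights w (suc j))) (sym (row-suffixWeights w j)) (suffixWeight-suc-≤ w j))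

-- Balanced and mechanical words

∣-∣≤1⇔ : ∀ m n → ∣ m - n ∣ ≤ 1 ⇔ (m ≤ suc n × n ≤ suc m)
∣-∣≤1⇔ m n = mk⇔
  (λ d≤1 → ≤-trans (m≤n+∣m-n∣ m n) (≤-trans (+-monoʳ-≤ n d≤1) (≤-reflexive (+-comm n 1))) ,
           ≤-trans (m≤n+∣n-m∣ n m) (≤-trans (+-monoʳ-≤ m d≤1) (≤-reflexive (+-comm m 1))))
  (λ (m≤1+n , n≤1+m) → close m n m≤1+n n≤1+m)
  where
  close : ∀ m n → m ≤ suc n → n ≤ suc m → ∣ m - n ∣ ≤ 1
  close zero          zero          _           _           = z≤n
  close zero          (suc zero)    _           _           = ≤-refl
  close (suc zero)    zero          _           _           = ≤-refl
  close (suc m)       (suc n)       (s≤s m≤1+n) (s≤s n≤1+m) = close m n m≤1+n n≤1+m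
  close zero          (suc (suc n)) _           (s≤s ())
  close (suc (suc m)) zero          (s≤s ())    _

balanced⇒≤suc : ∀ {w} → Balanced w → ∀ h i j → i + h ≤ length w → j + h ≤ length w →
                window i h w ≤ suc (window j h w)
balanced⇒≤suc bal h i j ih jh = proj₁ (to (∣-∣≤1⇔ _ _) (bal h i j (≤-trans (m≤n+m h i) ih) ih jh))

balanced-fromWindows : ∀ {w} → (∀ h i j → i + h ≤ length w → j + h ≤ length w → window i h w ≤ suc (window j h w)) →
                       Balanced w
balanced-fromWindows ≤suc h i j _ ih jh = from (∣-∣≤1⇔ _ _) (≤suc h i j ih jh , ≤suc h j i jh ih)

∀<? : ∀ {P : ℕ → Set} → (∀ n → Dec (P n)) → ∀ N → Dec (∀ n → n < N → P n)
∀<? P? zero    = yes λ _ ()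
∀<? P? (suc N) with ∀<? P? N | P? N
... | no ¬all | _      = no λ all → ¬all λ n n<N → all n (m<n⇒m<1+n n<N)
... | yes _   | no ¬pN = no λ all → ¬pN (all N ≤-refl)
... | yes all | yes pN = yes λ n n<1+N → [ all n , (λ { refl → pN }) ] (m<1+n⇒m<n∨m≡n n<1+N)

balanced? : ∀ w → Dec (Balanced w)
balanced? w = map′ bounded⇒balanced (λ bal h _ i _ j _ → bal h i j)
  (∀<? (λ h → ∀<? (λ i → ∀<? (λ j → close? h i j) (suc L)) (suc L)) (suc L))
  where
  L = length w
  Close : ℕ → ℕ → ℕ → Set
  Close h i j = h ≤ L → i + h ≤ L → j + h ≤ L → ∣ window i h w - window j h w ∣ ≤ 1
  close? : ∀ h i j → Dec (Close h i j)
  close? h i j = (h ≤? L) →-dec (i + h ≤? L) →-dec (j + h ≤? L) →-dec (∣ window i h w - window j h w ∣ ≤? 1)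
  bounded⇒balanced : (∀ h → h < suc L → ∀ i → i < suc L → ∀ j → j < suc L → Close h i j) → Balanced w
  bounded⇒balanced close h i j h≤L ih jh =
    close h (s≤s h≤L) i (s≤s (≤-trans (m≤m+n i h) ih)) j (s≤s (≤-trans (m≤m+n j h) jh)) h≤L ih jh

window-map-not : ∀ w i h → i + h ≤ length w → window i h (map not w) + window i h w ≡ h
window-map-not w i h ih = begin
  weight (take h (drop i (map not w))) + window i h w   ≡⟨ cong (λ v → weight (take h v) + window i h w) (drop-map i w) ⟩
  weight (take h (map not (drop i w))) + window i h w   ≡⟨ cong (λ v → weight v + window i h w) (take-map h (drop i w)) ⟩
  weight (map not v) + weight v                         ≡⟨ weight-map-not v ⟩
  length v                                              ≡⟨ length-take h (drop i w) ⟩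
  h ⊓ length (drop i w)                                 ≡⟨ m≤n⇒m⊓n≡m h≤ ⟩
  h                                                     ∎
  where
  open ≡-Reasoning
  v = take h (drop i w)
  h≤ : h ≤ length (drop i w)
  h≤ = subst (h ≤_) (sym (length-drop i w)) (m+n≤o⇒m≤o∸n h (subst (_≤ length w) (+-comm i h) ih))
  weight-map-not : ∀ u → weight (map not u) + weight u ≡ length u
  weight-map-not []          = refl
  weight-map-not (true ∷ u)  = trans (+-suc (weight (map not u)) (weight u)) (cong suc (weight-map-not u))
  weight-map-not (false ∷ u) = cong suc (weight-map-not u)

balanced-map-not : ∀ {w} → Balanced w → Balanced (map not w)
balanced-map-not {w} bal = balanced-fromWindows λ h i j ih jh →
  let ih′ = subst (i + h ≤_) (length-map not w) ih
      jh′ = subst (j + h ≤_) (length-map not w) jh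
  in +-cancelʳ-≤ (window i h w) _ _ (begin
    window i h (map not w) + window i h w          ≡⟨ window-map-not w i h ih′ ⟩
    h                                              ≡⟨ sym (window-map-not w j h jh′) ⟩
    window j h (map not w) + window j h w          ≤⟨ +-monoʳ-≤ (window j h (map not w)) (balanced⇒≤suc bal h j i jh′ ih′) ⟩
    window j h (map not w) + suc (window i h w)    ≡⟨ +-suc _ _ ⟩
    suc (window j h (map not w)) + window i h w    ∎)
  where open ≤-Reasoning

-- ∣ window i m w - m Q / P ∣ < 1, cleared of the denominator P.
Mechanical : ℕ → ℕ → List Bool → Set
Mechanical P Q w = ∀ i m → i + m ≤ length w →
  window i m w * P < m * Q + P × m * Q < window i m w * P + P

mechanical⇒balanced : ∀ {P Q w} → Mechanical P Q w → Balanced w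
mechanical⇒balanced {P} {Q} {w} mech = balanced-fromWindows λ h i j ih jh →
  ≤-pred (*-cancelʳ-< P _ _ (begin-strict
    window i h w * P          <⟨ proj₁ (mech i h ih) ⟩
    h * Q + P                 <⟨ +-monoˡ-< P (proj₂ (mech j h jh)) ⟩
    window j h w * P + P + P  ≡⟨ two-more (window j h w) P ⟩
    suc (suc (window j h w)) * P ∎))
  where
  open ≤-Reasoning
  two-more : ∀ x P → x * P + P + P ≡ suc (suc x) * P
  two-more = solve-∀

mechanical-weight⇒1≤Q : ∀ {P Q w} → Mechanical P Q w → 1 ≤ weight w → 1 ≤ Q
mechanical-weight⇒1≤Q {P} {zero} {w} mech 1≤weight = ⊥-elim (<-irrefl refl (begin-strict
  P                              ≡⟨ sym (*-identityˡ P) ⟩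
  1 * P                          ≤⟨ *-monoˡ-≤ P 1≤weight ⟩
  weight w * P                   ≡⟨ cong (λ v → weight v * P) (sym (take-all (length w) w ≤-refl)) ⟩
  window 0 (length w) w * P      <⟨ proj₁ (mech 0 (length w) ≤-refl) ⟩
  length w * 0 + P               ≡⟨ cong (_+ P) (*-zeroʳ (length w)) ⟩
  P                              ∎))
  where open ≤-Reasoning
mechanical-weight⇒1≤Q {Q = suc _} _ _ = s≤s z≤n

private
  gap-equal : ∀ W₁ W₂ m → 1 ≤ m → W₁ ≤ suc W₂ → W₁ * m < W₂ * m + m + m
  gap-equal W₁ W₂ m 1≤m W₁≤ = subst₂ _≤_ (e₁ W₁ m) (e₂ W₂ m) (+-mono-≤ (*-monoˡ-≤ m W₁≤) 1≤m)
    where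
    e₁ : ∀ W₁ m → W₁ * m + 1 ≡ suc (W₁ * m)
    e₁ = solve-∀
    e₂ : ∀ W₂ m → suc W₂ * m + m ≡ W₂ * m + m + m
    e₂ = solve-∀

  gap-split-right : ∀ W₁ T U m k → W₁ ≤ suc T → W₁ * k < U * m + m + k →
                    W₁ * (m + k) < (T + U) * m + m + (m + k)
  gap-split-right W₁ T U m k W₁≤ gap = subst₂ _≤_ (e₁ W₁ m k) (e₂ T U m k) (+-mono-≤ (*-monoˡ-≤ m W₁≤) gap)
    where
    e₁ : ∀ W₁ m k → W₁ * m + suc (W₁ * k) ≡ suc (W₁ * (m + k))
    e₁ = solve-∀
    e₂ : ∀ T U m k → suc T * m + (U * m + m + k) ≡ (T + U) * m + m + (m + k)
    e₂ = solve-∀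

  gap-split-left : ∀ T U W₂ m k → T ≤ suc W₂ → U * m < W₂ * k + k + m →
                   (T + U) * m < W₂ * (m + k) + (m + k) + m
  gap-split-left T U W₂ m k T≤ gap = subst₂ _≤_ (e₁ T U m) (e₂ W₂ m k) (+-mono-≤ (*-monoˡ-≤ m T≤) gap)
    where
    e₁ : ∀ T U m → T * m + suc (U * m) ≡ suc ((T + U) * m)
    e₁ = solve-∀
    e₂ : ∀ W₂ m k → suc W₂ * m + (W₂ * k + k + m) ≡ W₂ * (m + k) + (m + k) + m
    e₂ = solve-∀

  m<m+n⇒1≤n : ∀ {m n} → m < m + n → 1 ≤ n
  m<m+n⇒1≤n {m} {zero}  m<m+0 = ⊥-elim (<-irrefl (sym (+-identityʳ m)) m<m+0)
  m<m+n⇒1≤n {m} {suc n} _     = s≤s z≤n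

-- W₁ / m₁ - W₂ / m₂ < 1 / m₁ + 1 / m₂ for factors of weights W₁, W₂; by induction on m₁ + m₂, cutting the
-- longer factor into a piece as long as the shorter one and a remainder, as in Euclid's algorithm.
balanced⇒slope-gap : ∀ {w} → Balanced w → ∀ {m₁ m₂} i₁ i₂ → 1 ≤ m₁ → 1 ≤ m₂ →
  i₁ + m₁ ≤ length w → i₂ + m₂ ≤ length w → window i₁ m₁ w * m₂ < window i₂ m₂ w * m₁ + m₁ + m₂
balanced⇒slope-gap {w} bal {m₁} {m₂} = gap (m₁ + m₂) ≤-refl
  where
  W : ℕ → ℕ → ℕ
  W i m = window i m w

  gap : ∀ n {m₁ m₂} → m₁ + m₂ ≤ n → ∀ i₁ i₂ → 1 ≤ m₁ → 1 ≤ m₂ → i₁ + m₁ ≤ length w → i₂ + m₂ ≤ length w →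
        W i₁ m₁ * m₂ < W i₂ m₂ * m₁ + m₁ + m₂
  gap zero {suc _} () _ _ _ _ _ _
  gap (suc n) {m₁} {m₂} m≤n i₁ i₂ 1≤m₁ 1≤m₂ v₁ v₂ with <-cmp m₁ m₂
  ... | tri≈ _ refl _ = gap-equal (W i₁ m₁) (W i₂ m₁) m₁ 1≤m₁ (balanced⇒≤suc bal m₁ i₁ i₂ v₁ v₂)
  ... | tri< m₁<m₂ _ _ = split₂ (m≤n⇒∃[o]m+o≡n (<⇒≤ m₁<m₂)) m₁<m₂ m≤n v₂
    where
    split₂ : ∀ {m₂} → Σ ℕ (λ k → m₁ + k ≡ m₂) → m₁ < m₂ → m₁ + m₂ ≤ suc n → i₂ + m₂ ≤ length w →
             W i₁ m₁ * m₂ < W i₂ m₂ * m₁ + m₁ + m₂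
    split₂ (k , refl) m₁<m₂ m≤n v₂ = subst (λ x → W i₁ m₁ * (m₁ + k) < x * m₁ + m₁ + (m₁ + k)) (sym (window-+ w i₂ m₁ k))
      (gap-split-right (W i₁ m₁) (W i₂ m₁) (W (i₂ + m₁) k) m₁ k
        (balanced⇒≤suc bal m₁ i₁ i₂ v₁ (≤-trans (+-monoʳ-≤ i₂ (m≤m+n m₁ k)) v₂))
        (gap n (≤-pred (≤-trans (+-monoˡ-< (m₁ + k) 1≤m₁) m≤n)) i₁ (i₂ + m₁) 1≤m₁ (m<m+n⇒1≤n m₁<m₂) v₁
             (subst (_≤ length w) (sym (+-assoc i₂ m₁ k)) v₂)))
  ... | tri> _ _ m₂<m₁ = split₁ (m≤n⇒∃[o]m+o≡n (<⇒≤ m₂<m₁)) m₂<m₁ m≤n v₁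
    where
    split₁ : ∀ {m₁} → Σ ℕ (λ k → m₂ + k ≡ m₁) → m₂ < m₁ → m₁ + m₂ ≤ suc n → i₁ + m₁ ≤ length w →
             W i₁ m₁ * m₂ < W i₂ m₂ * m₁ + m₁ + m₂
    split₁ (k , refl) m₂<m₁ m≤n v₁ = subst (λ x → x * m₂ < W i₂ m₂ * (m₂ + k) + (m₂ + k) + m₂) (sym (window-+ w i₁ m₂ k))
      (gap-split-left (W i₁ m₂) (W (i₁ + m₂) k) (W i₂ m₂) m₂ k
        (balanced⇒≤suc bal m₂ i₁ i₂ (≤-trans (+-monoʳ-≤ i₁ (m≤m+n m₂ k)) v₁) v₂)
        (gap n (≤-pred (≤-trans (subst (suc (k + m₂) ≤_) (sym (+-assoc m₂ k m₂)) (+-monoˡ-≤ (k + m₂) 1≤m₂)) m≤n))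
             (i₁ + m₂) i₂ (m<m+n⇒1≤n m₂<m₁) 1≤m₂ (subst (_≤ length w) (sym (+-assoc i₁ m₂ k)) v₁) v₂))

private
  ℚᵘ-≤⇒ : ∀ {x d y e} → mkℚᵘ (ℤ.+ x) d ℚᵘ.≤ mkℚᵘ (ℤ.+ y) e → x * suc e ≤ y * suc d
  ℚᵘ-≤⇒ {x} {d} {y} {e} (ℚᵘ.*≤* le) = ℤ.drop‿+≤+ (subst₂ ℤ._≤_ (sym (ℤ.pos-* x (suc e))) (sym (ℤ.pos-* y (suc d))) le)

  -- The slope is the mediant of a factor maximising (W - 1) / m and a factor minimising (W + 1) / m.
  module Mediant {w : List Bool} (bal : Balanced w) (1≤L : 1 ≤ length w) where
    L = length w
    W : ℕ → ℕ → ℕ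
    W i m = window i m w

    Fits : ℕ × ℕ → Set
    Fits (i , d) = i + suc d ≤ L

    fits? : ∀ f → Dec (Fits f)
    fits? (i , d) = i + suc d ≤? L

    factors : List (ℕ × ℕ)
    factors = filter fits? (cartesianProduct (upTo L) (upTo L))

    ∈factors : ∀ i d → Fits (i , d) → (i , d) ∈ factors
    ∈factors i d fits = ∈-filter⁺ fits?
      (∈-cartesianProduct⁺ (∈-upTo⁺ (≤-trans (s≤s (m≤m+n i d)) (subst (_≤ L) (+-suc i d) fits)))
                           (∈-upTo⁺ (≤-trans (m≤n+m (suc d) i) fits)))
      fits

    -- (W - 1) / m + 1 and (W + 1) / m for the factor of length m = d + 1 starting at i.
    lowSlope highSlope : ℕ × ℕ → ℚᵘ
    lowSlope  (i , d) = mkℚᵘ (ℤ.+ (W i (suc d) + d)) d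
    highSlope (i , d) = mkℚᵘ (ℤ.+ (W i (suc d) + 1)) d

    open Data.List.Extrema ℚᵘ.≤-totalOrder

    steepest flattest : ℕ × ℕ
    steepest = argmax lowSlope (0 , 0) factors
    flattest = argmin highSlope (0 , 0) factors

    i₁ d₁ i₂ d₂ m₁ m₂ W₁ W₂ : ℕ
    i₁ = proj₁ steepest
    d₁ = proj₂ steepest
    i₂ = proj₁ flattest
    d₂ = proj₂ flattest
    m₁ = suc d₁
    m₂ = suc d₂
    W₁ = W i₁ m₁
    W₂ = W i₂ m₂

    factors-fit : All Fits factors
    factors-fit = Allₚ.all-filter fits? (cartesianProduct (upTo L) (upTo L))

    steepest-fits : Fits steepest
    steepest-fits = argmax-all lowSlope {P = Fits} {⊥ = 0 , 0} 1≤L factors-fit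

    flattest-fits : Fits flattest
    flattest-fits = argmin-all highSlope {⊤ = 0 , 0} {P = Fits} 1≤L factors-fit

    below-steepest : ∀ i m → 1 ≤ m → i + m ≤ L → W i m * m₁ + m ≤ W₁ * m + m₁
    below-steepest i (suc d) _ fits = rearrange (W i (suc d)) d W₁ d₁
      (ℚᵘ-≤⇒ (All.lookup (f[xs]≤f[argmax] {f = lowSlope} (0 , 0) factors) (∈factors i d fits)))
      where
      rearrange : ∀ S d S₁ d₁ → (S + d) * suc d₁ ≤ (S₁ + d₁) * suc d → S * suc d₁ + suc d ≤ S₁ * suc d + suc d₁
      rearrange S d S₁ d₁ le = +-cancelʳ-≤ (d * d₁) _ _ (subst₂ _≤_ (e₁ S d d₁) (e₂ S₁ d₁ d) (s≤s le))
        where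
        e₁ : ∀ S d d₁ → suc ((S + d) * suc d₁) ≡ S * suc d₁ + suc d + d * d₁
        e₁ = solve-∀
        e₂ : ∀ S₁ d₁ d → suc ((S₁ + d₁) * suc d) ≡ S₁ * suc d + suc d₁ + d * d₁
        e₂ = solve-∀

    above-flattest : ∀ i m → 1 ≤ m → i + m ≤ L → W₂ * m + m ≤ W i m * m₂ + m₂
    above-flattest i (suc d) _ fits = rearrange W₂ d (W i (suc d)) d₂
      (ℚᵘ-≤⇒ (All.lookup (f[argmin]≤f[xs] {f = highSlope} (0 , 0) factors) (∈factors i d fits)))
      where
      rearrange : ∀ S₂ d S d₂ → (S₂ + 1) * suc d ≤ (S + 1) * suc d₂ → S₂ * suc d + suc d ≤ S * suc d₂ + suc d₂
      rearrange S₂ d S d₂ le = subst₂ _≤_ (e S₂ d) (e S d₂) le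
        where
        e : ∀ S d → (S + 1) * suc d ≡ S * suc d + suc d
        e = solve-∀

    mechanical : Mechanical (m₁ + m₂) (W₁ + W₂) w
    mechanical i zero    _    = s≤s z≤n , s≤s z≤n
    mechanical i (suc d) fits =
      combine₁ (W i m) m m₁ m₂ W₁ W₂ (below-steepest i m (s≤s z≤n) fits)
        (balanced⇒slope-gap bal i i₂ (s≤s z≤n) (s≤s z≤n) fits flattest-fits) ,
      combine₂ (W i m) m m₁ m₂ W₁ W₂ (above-flattest i m (s≤s z≤n) fits)
        (balanced⇒slope-gap bal i₁ i (s≤s z≤n) (s≤s z≤n) steepest-fits fits)
      where
      m = suc d
      combine₁ : ∀ S m m₁ m₂ S₁ S₂ → S * m₁ + m ≤ S₁ * m + m₁ → S * m₂ < S₂ * m + m + m₂ →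
                 S * (m₁ + m₂) < m * (S₁ + S₂) + (m₁ + m₂)
      combine₁ S m m₁ m₂ S₁ S₂ a b = +-cancelˡ-≤ m _ _ (subst₂ _≤_ (e₁ S m m₁ m₂) (e₂ S₁ S₂ m m₁ m₂) (+-mono-≤ a b))
        where
        e₁ : ∀ S m m₁ m₂ → S * m₁ + m + suc (S * m₂) ≡ m + suc (S * (m₁ + m₂))
        e₁ = solve-∀
        e₂ : ∀ S₁ S₂ m m₁ m₂ → S₁ * m + m₁ + (S₂ * m + m + m₂) ≡ m + (m * (S₁ + S₂) + (m₁ + m₂))
        e₂ = solve-∀
      combine₂ : ∀ S m m₁ m₂ S₁ S₂ → S₂ * m + m ≤ S * m₂ + m₂ → S₁ * m < S * m₁ + m₁ + m →
                 m * (S₁ + S₂) < S * (m₁ + m₂) + (m₁ + m₂)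
      combine₂ S m m₁ m₂ S₁ S₂ a b = +-cancelˡ-≤ m _ _ (subst₂ _≤_ (e₁ S₁ S₂ m) (e₂ S m m₁ m₂) (+-mono-≤ a b))
        where
        e₁ : ∀ S₁ S₂ m → S₂ * m + m + suc (S₁ * m) ≡ m + suc (m * (S₁ + S₂))
        e₁ = solve-∀
        e₂ : ∀ S m m₁ m₂ → S * m₂ + m₂ + (S * m₁ + m₁ + m) ≡ m + (S * (m₁ + m₂) + (m₁ + m₂))
        e₂ = solve-∀

balanced⇒mechanical : ∀ {w} → Balanced w → Σ ℕ λ P → Σ ℕ λ Q → 1 ≤ P × Mechanical P Q w
balanced⇒mechanical {[]}        _   = 1 , 0 , ≤-refl , empty
  where
  empty : Mechanical 1 0 []
  empty i m i+m≤0 with n≤0⇒n≡0 (m+n≤o⇒n≤o i i+m≤0)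
  ... | refl = ≤-refl , ≤-refl
balanced⇒mechanical {w@(_ ∷ _)} bal = _ , _ , s≤s z≤n , Mediant.mechanical bal (s≤s z≤n)

-- From mechanical words to triangular partitions

-- The suffix weights are cut by a P + b Q ≤ B for B the maximum of V j = suffixWeight w j · P + (j + 1) · Q,
-- because mechanicity makes V vary by less than P.
module _ {P Q : ℕ} {w : List Bool} (mech : Mechanical P Q w) where
  private
    L = length w
    V : ℕ → ℕ
    V j = suffixWeight w j * P + suc j * Q

    V-step : ∀ j m → j + m ≤ L → V (j + m) < V j + P × V j < V (j + m) + P
    V-step j m fits =
      subst₂ _<_ (e₁ y j m P Q) (trans (e₂ S y j P Q) (cong (_+ P) (sym V≡))) (+-monoʳ-< (y * P + suc j * Q) (proj₂ (mech j m fits))) ,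
      subst₂ _<_ (trans (e₃ S y j P Q) (sym V≡)) (e₄ y j m P Q) (+-monoʳ-< (y * P + suc j * Q) (proj₁ (mech j m fits)))
      where
      S = window j m w
      y = suffixWeight w (j + m)
      V≡ : V j ≡ (S + y) * P + suc j * Q
      V≡ = cong (λ x → x * P + suc j * Q) (sym (window+suffixWeight w j m))
      e₁ : ∀ y j m P Q → y * P + suc j * Q + m * Q ≡ y * P + suc (j + m) * Q
      e₁ = solve-∀
      e₂ : ∀ S y j P Q → y * P + suc j * Q + (S * P + P) ≡ (S + y) * P + suc j * Q + P
      e₂ = solve-∀
      e₃ : ∀ S y j P Q → y * P + suc j * Q + S * P ≡ (S + y) * P + suc j * Q
      e₃ = solve-∀
      e₄ : ∀ y j m P Q → y * P + suc j * Q + (m * Q + P) ≡ y * P + suc (j + m) * Q + P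
      e₄ = solve-∀

    V-gap : ∀ j k → j ≤ L → k ≤ L → V k < V j + P
    V-gap j k j≤L k≤L with ≤-total j k
    ... | inj₁ j≤k with m≤n⇒∃[o]m+o≡n j≤k
    ...   | m , refl = proj₁ (V-step j m k≤L)
    V-gap j k j≤L k≤L | inj₂ k≤j with m≤n⇒∃[o]m+o≡n k≤j
    ...   | m , refl = proj₂ (V-step k m j≤L)

    top : ℕ
    top = Extremaℕ.argmax V 0 (upTo (suc L))

    top≤L : top ≤ L
    top≤L = Extremaℕ.argmax-all V {P = _≤ L} z≤n (All.tabulate λ j∈ → ≤-pred (∈-upTo⁻ j∈))

    B : ℕ
    B = V top

    V≤B : ∀ j → j ≤ L → V j ≤ B
    V≤B j j≤L = All.lookup (Extremaℕ.f[xs]≤f[argmax] {f = V} 0 (upTo (suc L))) (∈-upTo⁺ (s≤s j≤L))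

    B<V+P : ∀ j → B < V j + P
    B<V+P j with j <? suc L
    ... | yes j<1+L = V-gap j top (≤-pred j<1+L) top≤L
    ... | no  j≮1+L = <-≤-trans (V-gap L top ≤-refl top≤L) (+-monoˡ-≤ P (begin
      suffixWeight w L * P + suc L * Q ≡⟨ cong (λ x → x * P + suc L * Q) (suffixWeight-≥length w ≤-refl) ⟩
      suc L * Q                        ≤⟨ *-monoˡ-≤ Q (s≤s L≤j) ⟩
      suc j * Q                        ≡⟨ cong (λ x → x * P + suc j * Q) (sym (suffixWeight-≥length w L≤j)) ⟩
      suffixWeight w j * P + suc j * Q ∎))
      where
      open ≤-Reasoning
      L≤j : L ≤ j
      L≤j = <⇒≤ (≰⇒> (λ j≤L → j≮1+L (s≤s j≤L)))

  mechanical⇒cutBy : 1 ≤ Q → Σ ℕ λ B → 1 ≤ B × CutBy P Q B (suffixWeights w)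
  mechanical⇒cutBy 1≤Q = B , 1≤B , cut
    where
    1≤B : 1 ≤ B
    1≤B = begin
      1                                ≤⟨ 1≤Q ⟩
      Q                                ≡⟨ sym (*-identityˡ Q) ⟩
      1 * Q                            ≤⟨ m≤n+m (1 * Q) (weight w * P) ⟩
      V 0                              ≤⟨ V≤B 0 z≤n ⟩
      B                                ∎
      where open ≤-Reasoning
    cut : CutBy P Q B (suffixWeights w)
    cut = cutBy-fromRows λ a j 1≤a → subst (λ x → a ≤ x ⇔ (a * P + suc j * Q ≤ B)) (sym (row-suffixWeights w j))
      (mk⇔ (inside⇒below a j 1≤a) (below⇒inside a j))
      where
      inside⇒below : ∀ a j → 1 ≤ a → a ≤ suffixWeight w j → a * P + suc j * Q ≤ B
      inside⇒below a j 1≤a a≤ = ≤-trans (+-monoˡ-≤ (suc j * Q) (*-monoˡ-≤ P a≤)) (V≤B j j≤L)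
        where
        j≤L : j ≤ L
        j≤L with j <? L
        ... | yes j<L = <⇒≤ j<L
        ... | no  j≮L = ⊥-elim (<⇒≱ (≤-trans 1≤a a≤) (≤-reflexive (suffixWeight-≥length w (≮⇒≥ j≮L))))
      below⇒inside : ∀ a j → a * P + suc j * Q ≤ B → a ≤ suffixWeight w j
      below⇒inside a j below = ≤-pred (*-cancelʳ-< P a (suc (suffixWeight w j)) (+-cancelʳ-< (suc j * Q) _ _ (begin-strict
        a * P + suc j * Q                        ≤⟨ below ⟩
        B                                        <⟨ B<V+P j ⟩
        suffixWeight w j * P + suc j * Q + P     ≡⟨ shift (suffixWeight w j) P (suc j * Q) ⟩
        suc (suffixWeight w j) * P + suc j * Q   ∎)))
        where
        open ≤-Reasoning
        shift : ∀ x P y → x * P + y + P ≡ suc x * P + y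
        shift = solve-∀

-- From triangular partitions to mechanical words

differenceWord : List ℕ → List Bool
differenceWord []      = []
differenceWord (x ∷ p) = (row p 0 <ᵇ x) ∷ differenceWord p

length-differenceWord : ∀ p → length (differenceWord p) ≡ length p
length-differenceWord []      = refl
length-differenceWord (x ∷ p) = cong suc (length-differenceWord p)

last-differenceWord : ∀ {p} → IsPartition p → 1 ≤ length p → last (differenceWord p) ≡ just true
last-differenceWord {suc x ∷ []}    _    _ = refl
last-differenceWord {x ∷ y ∷ p}     part _ = last-differenceWord (isPartition-tail part) (s≤s z≤n)
last-differenceWord {zero ∷ []}     (() ∷ _ , _) _

suffixWeights-differenceWord : ∀ {p} → IsPartition p → (∀ j → row p j ≤ suc (row p (suc j))) →
                               suffixWeights (differenceWord p) ≡ p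
suffixWeights-differenceWord {[]}    _    _     = refl
suffixWeights-differenceWord {x ∷ p} part steps = cong₂ _∷_ head tail
  where
  tail : suffixWeights (differenceWord p) ≡ p
  tail = suffixWeights-differenceWord (isPartition-tail part) (λ j → steps (suc j))
  bit-<ᵇ : ∀ y x → y ≤ x → x ≤ suc y → bit (y <ᵇ x) + y ≡ x
  bit-<ᵇ zero    zero          _       _       = refl
  bit-<ᵇ zero    (suc zero)    _       _       = refl
  bit-<ᵇ (suc y) (suc x)       (s≤s a) (s≤s b) = trans (+-suc (bit (y <ᵇ x)) y) (cong suc (bit-<ᵇ y x a b))
  bit-<ᵇ zero    (suc (suc x)) _       (s≤s ())
  head : bit (row p 0 <ᵇ x) + weight (differenceWord p) ≡ x
  head = trans (cong (bit (row p 0 <ᵇ x) +_) (trans (sym (row-suffixWeights (differenceWord p) 0)) (cong (λ q → row q 0) tail)))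
               (bit-<ᵇ (row p 0) x (row-suc-≤ part 0) (steps 0))

-- Row j is the largest x with x P + (j + 1) Q ≤ B, so for Q ≤ P consecutive rows differ by at most one.
module _ {P Q B : ℕ} {p : List ℕ} (part : IsPartition p) (cut : CutBy P Q B p) (Q≤P : Q ≤ P) (1≤l : 1 ≤ length p) where
  private
    l = length p
    x : ℕ → ℕ
    x = row p

    below : ∀ j → j < l → x j * P + suc j * Q ≤ B
    below j j<l = to (cutBy-row cut (x j) j (row-positive part j<l)) ≤-refl

    below′ : ∀ j → j ≤ l → x j * P + suc j * Q ≤ B
    below′ j j≤l with j <? l
    ... | yes j<l = below j j<l
    ... | no  j≮l with ≤-antisym j≤l (≮⇒≥ j≮l)
    ...   | refl = begin
      x l * P + suc l * Q           ≡⟨ cong (λ y → y * P + suc l * Q) (row-≥length p ≤-refl) ⟩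
      suc l * Q                     ≡⟨ cong (λ k → suc k * Q) (sym (m∸n+n≡m 1≤l)) ⟩
      Q + (l ∸ 1 + 1) * Q           ≤⟨ +-monoˡ-≤ ((l ∸ 1 + 1) * Q) Q≤lastRow ⟩
      x (l ∸ 1) * P + (l ∸ 1 + 1) * Q ≡⟨ cong (λ k → x (l ∸ 1) * P + k * Q) (+-comm (l ∸ 1) 1) ⟩
      x (l ∸ 1) * P + suc (l ∸ 1) * Q ≤⟨ below (l ∸ 1) l-1<l ⟩
      B                             ∎
      where
      open ≤-Reasoning
      l-1<l : l ∸ 1 < l
      l-1<l = ≤-reflexive (trans (+-comm 1 (l ∸ 1)) (m∸n+n≡m 1≤l))
      Q≤lastRow : Q ≤ x (l ∸ 1) * P
      Q≤lastRow = ≤-trans Q≤P (≤-trans (≤-reflexive (sym (*-identityˡ P))) (*-monoˡ-≤ P (row-positive part l-1<l)))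

    above : ∀ j → B < x j * P + P + suc j * Q
    above j = ≰⇒> λ le → <-irrefl refl (from (cutBy-row cut (suc (x j)) j (s≤s z≤n)) (subst (_≤ B) (e (x j) P (suc j * Q)) le))
      where
      e : ∀ x P y → x * P + P + y ≡ suc x * P + y
      e = solve-∀

    rows-close : ∀ i m → i + m ≤ l → x (i + m) * P + m * Q < x i * P + P × x i * P < x (i + m) * P + P + m * Q
    rows-close i m fits =
      +-cancelʳ-< (suc i * Q) _ _ (subst (_< x i * P + P + suc i * Q) (e₁ (x (i + m)) i m P Q)
        (≤-<-trans (below′ (i + m) fits) (above i))) ,
      +-cancelʳ-< (suc i * Q) _ _ (subst (x i * P + suc i * Q <_) (e₂ (x (i + m)) i m P Q)
        (≤-<-trans (below′ i (≤-trans (m≤m+n i m) fits)) (above (i + m))))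
      where
      e₁ : ∀ y i m P Q → y * P + suc (i + m) * Q ≡ y * P + m * Q + suc i * Q
      e₁ = solve-∀
      e₂ : ∀ y i m P Q → y * P + P + suc (i + m) * Q ≡ y * P + P + m * Q + suc i * Q
      e₂ = solve-∀

    steps≤1 : ∀ j → x j ≤ suc (x (suc j))
    steps≤1 j with suc j ≤? l
    ... | yes 1+j≤l = ≤-pred (*-cancelʳ-< P (x j) (suc (suc (x (suc j)))) (begin-strict
      x j * P                       <⟨ proj₂ (rows-close j 1 (subst (_≤ l) (+-comm 1 j) 1+j≤l)) ⟩
      x (j + 1) * P + P + 1 * Q     ≡⟨ cong (λ k → x k * P + P + 1 * Q) (+-comm j 1) ⟩
      x (suc j) * P + P + 1 * Q     ≤⟨ +-monoʳ-≤ (x (suc j) * P + P) (≤-trans (≤-reflexive (*-identityˡ Q)) Q≤P) ⟩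
      x (suc j) * P + P + P         ≡⟨ e (x (suc j)) P ⟩
      suc (suc (x (suc j))) * P     ∎))
      where
      open ≤-Reasoning
      e : ∀ y P → y * P + P + P ≡ suc (suc y) * P
      e = solve-∀
    ... | no  1+j≰l = subst (_≤ suc (x (suc j))) (sym (row-≥length p (≤-pred (≰⇒> 1+j≰l)))) z≤n

  cutBy⇒suffixWeights-differenceWord : suffixWeights (differenceWord p) ≡ p
  cutBy⇒suffixWeights-differenceWord = suffixWeights-differenceWord part steps≤1

  cutBy⇒mechanical-differenceWord : Mechanical P Q (differenceWord p)
  cutBy⇒mechanical-differenceWord i m fits′ =
    +-cancelʳ-< (y * P) _ _ (subst₂ _<_ (e₁ W y P) (e₂ y m P Q)
      (subst (λ z → z * P < y * P + P + m * Q) (sym W+y≡x) (proj₂ (rows-close i m fits)))) ,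
    +-cancelʳ-< (y * P) _ _ (subst₂ _<_ (e₃ y m P Q) (e₄ W y P)
      (subst (λ z → y * P + m * Q < z * P + P) (sym W+y≡x) (proj₁ (rows-close i m fits))))
    where
    w = differenceWord p
    fits : i + m ≤ l
    fits = subst (i + m ≤_) (length-differenceWord p) fits′
    W = window i m w
    y = x (i + m)
    W+y≡x : W + y ≡ x i
    W+y≡x = subst (λ q → W + row q (i + m) ≡ row q i) cutBy⇒suffixWeights-differenceWord
      (trans (cong (W +_) (row-suffixWeights w (i + m))) (trans (window+suffixWeight w i m) (sym (row-suffixWeights w i))))
    e₁ : ∀ W y P → (W + y) * P ≡ W * P + y * P
    e₁ = solve-∀
    e₂ : ∀ y m P Q → y * P + P + m * Q ≡ m * Q + P + y * P
    e₂ = solve-∀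
    e₃ : ∀ y m P Q → y * P + m * Q ≡ m * Q + y * P
    e₃ = solve-∀
    e₄ : ∀ W y P → (W + y) * P + P ≡ W * P + P + y * P
    e₄ = solve-∀

-- Triangular partitions in a box

private
  corner≤cell : ∀ {P Q} l a b → Q ≤ P → l ≤ a + b → 1 * P + suc l * Q ≤ suc a * P + suc b * Q
  corner≤cell {P} {Q} l a b Q≤P l≤a+b = begin
    1 * P + suc l * Q            ≡⟨ e₁ P Q l ⟩
    P + Q + l * Q                ≤⟨ +-monoʳ-≤ (P + Q) (*-monoˡ-≤ Q l≤a+b) ⟩
    P + Q + (a + b) * Q          ≡⟨ e₂ P Q a b ⟩
    P + Q + b * Q + a * Q        ≤⟨ +-monoʳ-≤ (P + Q + b * Q) (*-monoʳ-≤ a Q≤P) ⟩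
    P + Q + b * Q + a * P        ≡⟨ e₃ P Q a b ⟩
    suc a * P + suc b * Q        ∎
    where
    open ≤-Reasoning
    e₁ : ∀ P Q l → 1 * P + suc l * Q ≡ P + Q + l * Q
    e₁ = solve-∀
    e₂ : ∀ P Q a b → P + Q + (a + b) * Q ≡ P + Q + b * Q + a * Q
    e₂ = solve-∀
    e₃ : ∀ P Q a b → P + Q + b * Q + a * P ≡ suc a * P + suc b * Q
    e₃ = solve-∀

below-line⇒≤antidiagonal : ∀ {P Q B} l {a b} → ¬ (suc l * P + 1 * Q ≤ B) → ¬ (1 * P + suc l * Q ≤ B) →
                           1 ≤ a → 1 ≤ b → a * P + b * Q ≤ B → a + b ≤ suc l
below-line⇒≤antidiagonal {P} {Q} {B} l {suc a} {suc b} ¬right ¬top _ _ below with suc a + suc b ≤? suc l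
... | yes a+b≤ = a+b≤
... | no  a+b≰ = ⊥-elim (beyond (≤-pred (≤-pred (subst (suc (suc l) ≤_) (cong suc (+-suc a b)) (≰⇒> a+b≰)))))
  where
  beyond : l ≤ a + b → ⊥
  beyond l≤a+b with ≤-total Q P
  ... | inj₁ Q≤P = ¬top (≤-trans (corner≤cell l a b Q≤P l≤a+b) below)
  ... | inj₂ P≤Q = ¬right (≤-trans (subst₂ _≤_ (+-comm (1 * Q) (suc l * P)) (+-comm (suc b * Q) (suc a * P))
                                      (corner≤cell l b a P≤Q (subst (l ≤_) (+-comm a b) l≤a+b))) below)

cutBy-inBox⇒≤antidiagonal : ∀ {P Q B p} l → CutBy P Q B p → length p ≤ l → width p ≤ l →
                            ∀ a j → 1 ≤ a → a ≤ row p j → a + suc j ≤ suc l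
cutBy-inBox⇒≤antidiagonal {P} {Q} {B} {p} l cut len≤l width≤l a j 1≤a a≤row =
  below-line⇒≤antidiagonal l ¬right ¬top 1≤a (s≤s z≤n) (to (cutBy-row cut a j 1≤a) a≤row)
  where
  ¬right : ¬ (suc l * P + 1 * Q ≤ B)
  ¬right below = <⇒≱ ≤-refl (≤-trans (from (cutBy-row cut (suc l) 0 (s≤s z≤n)) below) (subst (_≤ l) (width≡row0 p) width≤l))
  ¬top : ¬ (1 * P + suc l * Q ≤ B)
  ¬top below with subst (1 ≤_) (row-≥length p len≤l) (from (cutBy-row cut 1 l ≤-refl) below)
  ... | ()

⊆staircase⇒inBox : ∀ {p} l → IsPartition p → p ⊆D staircase l → length p ≤ l × width p ≤ l
⊆staircase⇒inBox {p} l part sub = height≤ , width≤ p part sub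
  where
  width≤ : ∀ p → IsPartition p → p ⊆D staircase l → width p ≤ l
  width≤ []      _              _   = z≤n
  width≤ (x ∷ p) (1≤x ∷ _ , _) sub =
    subst (x ≤_) (row-staircase l 0) (proj₂ (to (inDiagram⇔≤row x 0 (staircase l)) (sub x 1 (1≤x , ≤-refl))))
  height≤ : length p ≤ l
  height≤ with length p in len
  ... | zero  = z≤n
  ... | suc h = m∸n≢0⇒n<m λ l∸h≡0 → <⇒≱ corner (≤-reflexive (trans (row-staircase l h) l∸h≡0))
    where
    corner : 1 ≤ row (staircase l) h
    corner = proj₂ (to (inDiagram⇔≤row 1 h (staircase l))
               (sub 1 (suc h) (from (inDiagram⇔≤row 1 h p) (≤-refl , row-positive part (subst (h <_) (sym len) ≤-refl)))))

inBox⇒⊆staircase : ∀ {P Q B p} l → CutBy P Q B p → length p ≤ l → width p ≤ l → p ⊆D staircase l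
inBox⇒⊆staircase {p = p} l cut len≤l width≤l a zero    ()
inBox⇒⊆staircase {p = p} l cut len≤l width≤l a (suc j) d =
  from (inDiagram⇔≤row a j (staircase l)) (1≤a , subst (a ≤_) (sym (row-staircase l j))
    (m+n≤o⇒m≤o∸n a (≤-pred (subst (_≤ suc l) (+-suc a j) (cutBy-inBox⇒≤antidiagonal l cut len≤l width≤l a j 1≤a a≤row)))))
  where
  1≤a = proj₁ (to (inDiagram⇔≤row a j p) d)
  a≤row = proj₂ (to (inDiagram⇔≤row a j p) d)

-- The conclusion says that p is the staircase of size l + 1.
cutBy-steep⇒antidiagonal : ∀ {P Q B p} l → IsPartition p → CutBy P Q B p → P ≤ Q →
                           length p ≡ suc l → width p ≤ suc l → CutBy 1 1 (suc (suc l)) p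
cutBy-steep⇒antidiagonal {P} {Q} {B} {p} l part cut P≤Q len≡ width≤ = cutBy-fromRows λ a j 1≤a → mk⇔
  (λ a≤row → subst (_≤ suc (suc l)) (sym (unit a j)) (cutBy-inBox⇒≤antidiagonal (suc l) cut (≤-reflexive len≡) width≤ a j 1≤a a≤row))
  (λ below → from (cutBy-row cut a j 1≤a) (≤-trans (stair a j 1≤a (subst (_≤ suc (suc l)) (unit a j) below)) corner))
  where
  unit : ∀ a j → a * 1 + suc j * 1 ≡ a + suc j
  unit = solve-∀
  corner : 1 * P + suc l * Q ≤ B
  corner = to (cutBy-row cut 1 l ≤-refl) (row-positive part (subst (l <_) (sym len≡) ≤-refl))
  stair : ∀ a j → 1 ≤ a → a + suc j ≤ suc (suc l) → a * P + suc j * Q ≤ 1 * P + suc l * Q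
  stair (suc a) j _ (s≤s a+j<l) = begin
    suc a * P + suc j * Q        ≡⟨ e₁ P Q a j ⟩
    P + (a * P + suc j * Q)      ≤⟨ +-monoʳ-≤ P (+-monoˡ-≤ (suc j * Q) (*-monoʳ-≤ a P≤Q)) ⟩
    P + (a * Q + suc j * Q)      ≡⟨ e₂ P Q a j ⟩
    P + (a + suc j) * Q          ≤⟨ +-monoʳ-≤ P (*-monoˡ-≤ Q a+j<l) ⟩
    P + suc l * Q                ≡⟨ cong (_+ suc l * Q) (sym (*-identityˡ P)) ⟩
    1 * P + suc l * Q            ∎
    where
    open ≤-Reasoning
    e₁ : ∀ P Q a j → suc a * P + suc j * Q ≡ P + (a * P + suc j * Q)
    e₁ = solve-∀
    e₂ : ∀ P Q a j → P + (a * Q + suc j * Q) ≡ P + (a + suc j) * Q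
    e₂ = solve-∀

-- Balanced words and triangular partitions of height or width l

InB₁ : ℕ → List Bool → Set
InB₁ l w = length w ≡ l × Balanced w × last w ≡ just true

HeightExactly : ℕ → List ℕ → Set
HeightExactly l p = IsPartition p × Triangular p × height p ≡ l × width p ≤ l

WidthExactly : ℕ → List ℕ → Set
WidthExactly l p = IsPartition p × Triangular p × width p ≡ l × height p ≤ l

mechanical⇒triangular : ∀ {P Q w} → 1 ≤ P → Mechanical P Q w → 1 ≤ weight w → Triangular (suffixWeights w)
mechanical⇒triangular {P} {Q} {w} 1≤P mech 1≤weight = lift (mechanical⇒cutBy mech 1≤Q)
  where
  1≤Q : 1 ≤ Q
  1≤Q = mechanical-weight⇒1≤Q mech 1≤weight
  lift : (Σ ℕ λ B → 1 ≤ B × CutBy P Q B (suffixWeights w)) → Triangular (suffixWeights w)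
  lift (B , 1≤B , cut) = triangularℕ⇒triangular (P , Q , B , 1≤P , 1≤Q , 1≤B , cut)

suffixWeights-heightExactly : ∀ {l w} → InB₁ l w → HeightExactly l (suffixWeights w)
suffixWeights-heightExactly {l} {w} (len , bal , ends) =
  isPartition-suffixWeights ends ,
  triangular (balanced⇒mechanical bal) ,
  trans (length-suffixWeights w) len ,
  subst (_≤ l) (sym (width-suffixWeights w)) (subst (weight w ≤_) len (weight≤length w))
  where
  triangular : (Σ ℕ λ P → Σ ℕ λ Q → 1 ≤ P × Mechanical P Q w) → Triangular (suffixWeights w)
  triangular (_ , _ , 1≤P , mech) = mechanical⇒triangular 1≤P mech (weight-positive w ends)

cutBy⇒suffixWeights : ∀ {P Q B p} → IsPartition p → CutBy P Q B p → Q ≤ P → 1 ≤ length p →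
                      Σ (List Bool) λ w → InB₁ (length p) w × suffixWeights w ≡ p
cutBy⇒suffixWeights {p = p} part cut Q≤P 1≤l =
  differenceWord p ,
  (length-differenceWord p , mechanical⇒balanced (cutBy⇒mechanical-differenceWord part cut Q≤P 1≤l) , last-differenceWord part 1≤l) ,
  cutBy⇒suffixWeights-differenceWord part cut Q≤P 1≤l

heightExactly⇒suffixWeights : ∀ {l p} → HeightExactly (suc l) p → Σ (List Bool) λ w → InB₁ (suc l) w × suffixWeights w ≡ p
heightExactly⇒suffixWeights {l} {p} (part , tri , len , width≤) =
  subst (λ n → Σ (List Bool) λ w → InB₁ n w × suffixWeights w ≡ p) len (fromCut (triangular⇒triangularℕ tri))
  where
  1≤l : 1 ≤ length p
  1≤l = subst (1 ≤_) (sym len) (s≤s z≤n)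
  fromCut : Triangularℕ p → Σ (List Bool) λ w → InB₁ (length p) w × suffixWeights w ≡ p
  fromCut (P , Q , B , _ , _ , _ , cut) with Q ≤? P
  ... | yes Q≤P = cutBy⇒suffixWeights part cut Q≤P 1≤l
  ... | no  Q≰P = cutBy⇒suffixWeights part (cutBy-steep⇒antidiagonal l part cut (<⇒≤ (≰⇒> Q≰P)) len width≤) ≤-refl 1≤l

heightExactly⇔ : ∀ {l p} → HeightExactly (suc l) p ⇔ (Σ (List Bool) λ w → InB₁ (suc l) w × suffixWeights w ≡ p)
heightExactly⇔ {l} {p} = mk⇔ heightExactly⇒suffixWeights
  λ (w , inB₁ , eq) → subst (HeightExactly (suc l)) eq (suffixWeights-heightExactly inB₁)

cutBy-conj : ∀ {P Q B p} → IsPartition p → CutBy P Q B p → CutBy Q P B (conj p)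
cutBy-conj {P} {Q} {B} part cut a b 1≤a 1≤b = mk⇔
  (λ d → subst (_≤ B) (+-comm (b * P) (a * Q)) (to (cut b a 1≤b 1≤a) (to (inDiagram-conj part a b) d)))
  (λ below → from (inDiagram-conj part a b) (from (cut b a 1≤b 1≤a) (subst (_≤ B) (+-comm (a * Q) (b * P)) below)))

triangular-conj : ∀ {p} → IsPartition p → Triangular p → Triangular (conj p)
triangular-conj {p} part tri = transpose (triangular⇒triangularℕ tri)
  where
  transpose : Triangularℕ p → Triangular (conj p)
  transpose (P , Q , B , 1≤P , 1≤Q , 1≤B , cut) = triangularℕ⇒triangular (Q , P , B , 1≤Q , 1≤P , 1≤B , cutBy-conj part cut)

heightExactly⇒widthExactly-conj : ∀ {l p} → HeightExactly l p → WidthExactly l (conj p)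
heightExactly⇒widthExactly-conj {l} {p} (part , tri , len , width≤) =
  isPartition-conj part , triangular-conj part tri , trans (width-conj part) len , subst (_≤ l) (sym (length-conj p)) width≤

widthExactly⇒heightExactly-conj : ∀ {l p} → WidthExactly l p → HeightExactly l (conj p)
widthExactly⇒heightExactly-conj {l} {p} (part , tri , width≡ , len≤) =
  isPartition-conj part , triangular-conj part tri , trans (length-conj p) width≡ , subst (_≤ l) (sym (width-conj part)) len≤

widthExactly⇔ : ∀ {l p} → WidthExactly (suc l) p ⇔ (Σ (List Bool) λ w → InB₁ (suc l) w × conj (suffixWeights w) ≡ p)
widthExactly⇔ {l} {p} = mk⇔
  (λ wide → let (w , inB₁ , sw≡) = to heightExactly⇔ (widthExactly⇒heightExactly-conj wide)
            in w , inB₁ , trans (cong conj sw≡) (conj-involutive (proj₁ wide)))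
  (λ (w , inB₁ , eq) → subst (WidthExactly (suc l)) eq (heightExactly⇒widthExactly-conj (suffixWeights-heightExactly inB₁)))

map-not-involutive : ∀ w → map not (map not w) ≡ w
map-not-involutive []      = refl
map-not-involutive (x ∷ w) = cong₂ _∷_ (Bool.not-involutive x) (map-not-involutive w)

inB⇔ : ∀ {l w} → InB (suc l) w ⇔ (InB₁ (suc l) w ⊎ Σ (List Bool) λ v → InB₁ (suc l) v × map not v ≡ w)
inB⇔ {l} {w} = mk⇔ (λ (len , bal) → byLast len bal (last w) refl) λ
  { (inj₁ (len , bal , _))             → len , bal
  ; (inj₂ (v , (len , bal , _) , refl)) → trans (length-map not v) len , balanced-map-not bal }
  where
  byLast : length w ≡ suc l → Balanced w → ∀ x → last w ≡ x →
           InB₁ (suc l) w ⊎ Σ (List Bool) λ v → InB₁ (suc l) v × map not v ≡ w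
  byLast len bal (just true)  ends = inj₁ (len , bal , ends)
  byLast len bal (just false) ends =
    inj₂ (map not w , (trans (length-map not w) len , balanced-map-not bal , trans (last-map not w) (cong (Maybe.map not) ends)) ,
          map-not-involutive w)
  byLast len bal nothing      ends = ⊥-elim (last-nonempty w (subst (1 ≤_) (sym len) (s≤s z≤n)) ends)
    where
    last-nonempty : ∀ w → 1 ≤ length w → last w ≢ nothing
    last-nonempty (x ∷ [])    _ ()
    last-nonempty (x ∷ y ∷ w) _ = last-nonempty (y ∷ w) (s≤s z≤n)

inB₁-¬complement : ∀ {l w} → InB₁ l w → ¬ (Σ (List Bool) λ v → InB₁ l v × map not v ≡ w)
inB₁-¬complement (_ , _ , ends) (v , (_ , _ , ends′) , refl) = just-true≢false (trans (sym ends) (last-map not v))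
  where
  just-true≢false : just true ≢ Maybe.map not (last v)
  just-true≢false eq with trans eq (cong (Maybe.map not) ends′)
  ... | ()

map-not-injective : ∀ {u v} → map not u ≡ map not v → u ≡ v
map-not-injective {u} {v} eq = trans (sym (map-not-involutive u)) (trans (cong (map not) eq) (map-not-involutive v))

window-replicate : ∀ n i h → i + h ≤ n → window i h (replicate n true) ≡ h
window-replicate n       zero    zero    _          = refl
window-replicate (suc n) zero    (suc h) (s≤s h≤n)  = cong suc (window-replicate n zero h h≤n)
window-replicate (suc n) (suc i) h       (s≤s ih≤n) = window-replicate n i h ih≤n

inB₁-replicate : ∀ l → InB₁ (suc l) (replicate (suc l) true)
inB₁-replicate l = length-replicate (suc l) , mechanical⇒balanced mechanical , ends l
  where
  mechanical : Mechanical 1 1 (replicate (suc l) true)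
  mechanical i m fits rewrite window-replicate (suc l) i m (subst (i + m ≤_) (length-replicate (suc l)) fits) =
    n<n+1 , n<n+1
    where
    n<n+1 : m * 1 < m * 1 + 1
    n<n+1 = ≤-reflexive (+-comm 1 (m * 1))
  ends : ∀ l → last (replicate (suc l) true) ≡ just true
  ends zero    = refl
  ends (suc l) = ends l

weight≡⇔≡replicate : ∀ {l w} → length w ≡ l → weight w ≡ l ⇔ w ≡ replicate l true
weight≡⇔≡replicate {w = w} refl = mk⇔ (full w) (λ w≡ → trans (cong weight w≡) (weight-replicate (length w)))
  where
  full : ∀ w → weight w ≡ length w → w ≡ replicate (length w) true
  full []          _  = refl
  full (true ∷ w)  eq = cong (true ∷_) (full w (suc-injective eq))
  full (false ∷ w) eq = ⊥-elim (<-irrefl refl (subst (_≤ length w) eq (weight≤length w)))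
  weight-replicate : ∀ n → weight (replicate n true) ≡ n
  weight-replicate zero    = refl
  weight-replicate (suc n) = cong suc (weight-replicate n)

height-conj-suffixWeights : ∀ w → height (conj (suffixWeights w)) ≡ weight w
height-conj-suffixWeights w = trans (length-conj (suffixWeights w)) (width-suffixWeights w)

new⇔ : ∀ {k p} → (InΔ (suc k) (suc k) p × ¬ InΔ k k p) ⇔
                 (HeightExactly (suc k) p ⊎ (WidthExactly (suc k) p × height p ≤ k))
new⇔ {k} {p} = mk⇔ split λ
  { (inj₁ (part , tri , len≡ , width≤)) →
      (part , tri , ≤-reflexive len≡ , width≤) , λ (_ , _ , len≤ , _) → 1+n≰n (subst (_≤ k) len≡ len≤)
  ; (inj₂ ((part , tri , width≡ , len≤) , _)) →
      (part , tri , len≤ , ≤-reflexive width≡) , λ (_ , _ , _ , width≤) → 1+n≰n (subst (_≤ k) width≡ width≤) }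
  where
  split : InΔ (suc k) (suc k) p × ¬ InΔ k k p → HeightExactly (suc k) p ⊎ (WidthExactly (suc k) p × height p ≤ k)
  split ((part , tri , len≤ , width≤) , ¬small) with length p ≟ suc k | width p ≤? k
  ... | yes len≡ | _        = inj₁ (part , tri , len≡ , width≤)
  ... | no  len≢ | yes width≤k = ⊥-elim (¬small (part , tri , ≤-pred (≤∧≢⇒< len≤ len≢) , width≤k))
  ... | no  len≢ | no  width≰k = inj₂ ((part , tri , ≤-antisym width≤ (≰⇒> width≰k) , len≤) , ≤-pred (≤∧≢⇒< len≤ len≢))

widthExactly-heightBelow⇔ : ∀ {k p} → (WidthExactly (suc k) p × height p ≤ k) ⇔
  (Σ (List Bool) λ w → (InB₁ (suc k) w × w ≢ replicate (suc k) true) × conj (suffixWeights w) ≡ p)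
widthExactly-heightBelow⇔ {k} {p} = mk⇔
  (λ (wide , len≤) → let (w , inB₁ , eq) = to widthExactly⇔ wide in
    w , (inB₁ , λ w≡1ˡ → 1+n≰n (begin
      suc k                            ≡⟨ sym (from (weight≡⇔≡replicate (proj₁ inB₁)) w≡1ˡ) ⟩
      weight w                         ≡⟨ sym (height-conj-suffixWeights w) ⟩
      height (conj (suffixWeights w))  ≡⟨ cong height eq ⟩
      height p                         ≤⟨ len≤ ⟩
      k                                ∎)) , eq)
  (λ (w , (inB₁ , w≢1ˡ) , eq) → from widthExactly⇔ (w , inB₁ , eq) , (begin
    height p                           ≡⟨ cong height (sym eq) ⟩
    height (conj (suffixWeights w))    ≡⟨ height-conj-suffixWeights w ⟩
    weight w                           ≤⟨ ≤-pred (≤∧≢⇒< (subst (weight w ≤_) (proj₁ inB₁) (weight≤length w))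
                                                        (w≢1ˡ ∘ to (weight≡⇔≡replicate (proj₁ inB₁)))) ⟩
    k                                  ∎))
  where open ≤-Reasoning

Δ-suc⇔ : ∀ {k p} → InΔ (suc k) (suc k) p ⇔ (InΔ k k p ⊎ (InΔ (suc k) (suc k) p × ¬ InΔ k k p))
Δ-suc⇔ {k} {p} = mk⇔ split λ
  { (inj₁ (part , tri , len≤ , width≤)) → part , tri , m≤n⇒m≤1+n len≤ , m≤n⇒m≤1+n width≤
  ; (inj₂ (big , _))                    → big }
  where
  split : InΔ (suc k) (suc k) p → InΔ k k p ⊎ (InΔ (suc k) (suc k) p × ¬ InΔ k k p)
  split big@(part , tri , _ , _) with length p ≤? k | width p ≤? k
  ... | yes len≤ | yes width≤ = inj₁ (part , tri , len≤ , width≤)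
  ... | no  len≰ | _          = inj₂ (big , λ (_ , _ , len≤ , _) → len≰ len≤)
  ... | yes _    | no  width≰ = inj₂ (big , λ (_ , _ , _ , width≤) → width≰ width≤)

countedByI-staircase⇔ : ∀ {l p} → CountedByI (staircase l) p ⇔ InΔ l l p
countedByI-staircase⇔ {l} {p} = mk⇔
  (λ (part , tri , sub) → let (len≤ , width≤) = ⊆staircase⇒inBox l part sub in part , tri , len≤ , width≤)
  (λ (part , tri , len≤ , width≤) → part , tri , inBox⇒⊆staircase′ (triangular⇒triangularℕ tri) len≤ width≤)
  where
  inBox⇒⊆staircase′ : Triangularℕ p → length p ≤ l → width p ≤ l → p ⊆D staircase l
  inBox⇒⊆staircase′ (_ , _ , _ , _ , _ , _ , cut) = inBox⇒⊆staircase l cut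

-- Finite cardinalities

module _ {A : Set} where

  hasCard-⇔ : ∀ {P Q : A → Set} {n} → (∀ x → P x ⇔ Q x) → HasCard P n → HasCard Q n
  hasCard-⇔ P⇔Q (xs , unique , mem , len) = xs , unique , (λ x → ⇔.trans (mem x) (P⇔Q x)) , len

  hasCard-⊎ : ∀ {P Q : A → Set} {m n} → HasCard P m → HasCard Q n → (∀ {x} → P x → ¬ Q x) →
              HasCard (λ x → P x ⊎ Q x) (m + n)
  hasCard-⊎ (xs , uxs , mxs , refl) (ys , uys , mys , refl) disjoint =
    xs ++ ys ,
    Unique.++⁺ uxs uys (λ (x∈xs , x∈ys) → disjoint (to (mxs _) x∈xs) (to (mys _) x∈ys)) ,
    (λ x → mk⇔ (λ x∈ → Sum.map (to (mxs x)) (to (mys x)) (∈-++⁻ xs x∈))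
               λ { (inj₁ px) → ∈-++⁺ˡ (from (mxs x) px) ; (inj₂ qx) → ∈-++⁺ʳ xs (from (mys x) qx) }) ,
    length-++ xs

  hasCard-split : ∀ {P Q : A → Set} {n} → Decidable Q → HasCard P n →
                  Σ ℕ λ a → Σ ℕ λ b → HasCard (λ x → P x × Q x) a × HasCard (λ x → P x × ¬ Q x) b × a + b ≡ n
  hasCard-split {P} {Q} Q? (xs , unique , mem , refl) =
    _ , _ ,
    (filter Q? xs , Unique.filter⁺ Q? unique , filtered Q? , refl) ,
    (filter (∁? Q?) xs , Unique.filter⁺ (∁? Q?) unique , filtered (∁? Q?) , refl) ,
    length-filter+length-filter xs
    where
    filtered : ∀ {R : A → Set} (R? : Decidable R) x → x ∈ filter R? xs ⇔ (P x × R x)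
    filtered R? x = mk⇔ (λ x∈ → let (x∈xs , rx) = ∈-filter⁻ R? x∈ in to (mem x) x∈xs , rx)
                        (λ (px , rx) → ∈-filter⁺ R? (from (mem x) px) rx)
    length-filter+length-filter : ∀ xs → length (filter Q? xs) + length (filter (∁? Q?) xs) ≡ length xs
    length-filter+length-filter []       = refl
    length-filter+length-filter (x ∷ xs) with Q? x
    ... | yes _ = cong suc (length-filter+length-filter xs)
    ... | no  _ = trans (+-suc _ _) (cong suc (length-filter+length-filter xs))

  hasCard-image : ∀ {B : Set} {P : A → Set} {n} (f : A → B) → (∀ {x y} → P x → P y → f x ≡ f y → x ≡ y) →
                  HasCard P n → HasCard (λ y → Σ A λ x → P x × f x ≡ y) n
  hasCard-image f injective (xs , unique , mem , refl) =
    map f xs ,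
    unique-map xs unique (λ x∈ y∈ → injective (to (mem _) x∈) (to (mem _) y∈)) ,
    (λ y → mk⇔ (λ y∈ → let (x , x∈ , y≡) = ∈-map⁻ f y∈ in x , to (mem x) x∈ , sym y≡)
               (λ (x , px , fx≡y) → subst (_∈ map f xs) fx≡y (∈-map⁺ f (from (mem x) px)))) ,
    length-map f xs
    where
    unique-map : ∀ xs → Unique xs → (∀ {x y} → x ∈ xs → y ∈ xs → f x ≡ f y → x ≡ y) → Unique (map f xs)
    unique-map []       []              _   = []
    unique-map (x ∷ xs) (x∉xs ∷ unique) inj =
      Allₚ.map⁺ (All.tabulate λ y∈ fx≡fy → All.lookup x∉xs y∈ (inj (here refl) (there y∈) fx≡fy)) ∷
      unique-map xs unique (λ x∈ y∈ → inj (there x∈) (there y∈))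

  hasCard-singleton : ∀ {x : A} {n} → HasCard (_≡ x) n → n ≡ 1
  hasCard-singleton {x} ([]         , _        , mem , refl) with from (mem x) refl
  ... | ()
  hasCard-singleton     (_ ∷ []     , _        , _   , refl) = refl
  hasCard-singleton     (y ∷ z ∷ xs , y∉ ∷ _   , mem , refl) =
    ⊥-elim (All.lookup y∉ (here refl) (trans (to (mem y) (here refl)) (sym (to (mem z) (there (here refl))))))

words : ℕ → List (List Bool)
words zero    = [] ∷ []
words (suc n) = map (true ∷_) (words n) ++ map (false ∷_) (words n)

hasCard-length : ∀ n → HasCard (λ (w : List Bool) → length w ≡ n) (2 ^ n)
hasCard-length n = words n , unique n , (λ w → mk⇔ (words⊆ n w) (⊆words n w)) , length-words n
  where
  words⊆ : ∀ n w → w ∈ words n → length w ≡ n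
  words⊆ zero    .[] (here refl) = refl
  words⊆ (suc n) w   w∈ with ∈-++⁻ (map (true ∷_) (words n)) w∈
  ... | inj₁ w∈₁ with ∈-map⁻ (true ∷_) w∈₁
  ...   | v , v∈ , refl = cong suc (words⊆ n v v∈)
  words⊆ (suc n) w   w∈ | inj₂ w∈₀ with ∈-map⁻ (false ∷_) w∈₀
  ...   | v , v∈ , refl = cong suc (words⊆ n v v∈)
  ⊆words : ∀ n w → length w ≡ n → w ∈ words n
  ⊆words zero    []          refl = here refl
  ⊆words (suc n) (true ∷ w)  len  = ∈-++⁺ˡ (∈-map⁺ (true ∷_) (⊆words n w (suc-injective len)))
  ⊆words (suc n) (false ∷ w) len  = ∈-++⁺ʳ (map (true ∷_) (words n)) (∈-map⁺ (false ∷_) (⊆words n w (suc-injective len)))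
  unique : ∀ n → Unique (words n)
  unique zero    = [] ∷ []
  unique (suc n) = Unique.++⁺ (Unique.map⁺ (λ eq → proj₂ (∷-injective eq)) (unique n))
                              (Unique.map⁺ (λ eq → proj₂ (∷-injective eq)) (unique n))
                              λ (w∈₁ , w∈₀) → disjoint w∈₁ w∈₀
    where
    disjoint : ∀ {w} → w ∈ map (true ∷_) (words n) → w ∈ map (false ∷_) (words n) → ⊥
    disjoint w∈₁ w∈₀ with ∈-map⁻ (true ∷_) w∈₁ | ∈-map⁻ (false ∷_) w∈₀
    ... | _ , _ , refl | _ , _ , ()
  length-words : ∀ n → length (words n) ≡ 2 ^ n
  length-words zero    = refl
  length-words (suc n) = begin
    length (map (true ∷_) (words n) ++ map (false ∷_) (words n))   ≡⟨ length-++ (map (true ∷_) (words n)) ⟩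
    length (map (true ∷_) (words n)) + length (map (false ∷_) (words n))
      ≡⟨ cong₂ _+_ (length-map (true ∷_) (words n)) (length-map (false ∷_) (words n)) ⟩
    length (words n) + length (words n)                            ≡⟨ cong₂ _+_ (length-words n) (length-words n) ⟩
    2 ^ n + 2 ^ n                                                  ≡⟨ cong (2 ^ n +_) (sym (+-identityʳ (2 ^ n))) ⟩
    2 ^ suc n                                                      ∎
    where open ≡-Reasoning

hasCard-inB₁ : ∀ l → Σ ℕ λ c → HasCard (InB₁ l) c
hasCard-inB₁ l with hasCard-split (λ w → balanced? w ×-dec Maybeₚ.≡-dec Bool._≟_ (last w) (just true)) (hasCard-length l)
... | c , _ , B₁ , _ = c , B₁

hasCard-inB₁-¬replicate : ∀ {k c} → HasCard (InB₁ (suc k)) c →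
  Σ ℕ λ b → HasCard (λ w → InB₁ (suc k) w × w ≢ replicate (suc k) true) b × suc b ≡ c
hasCard-inB₁-¬replicate {k} B₁ with hasCard-split (λ w → List.≡-dec Bool._≟_ w (replicate (suc k) true)) B₁
... | a , b , full , rest , a+b≡c =
  b , rest , trans (cong (_+ b) (sym (hasCard-singleton (hasCard-⇔ only-replicate full)))) a+b≡c
  where
  only-replicate : ∀ w → (InB₁ (suc k) w × w ≡ replicate (suc k) true) ⇔ (w ≡ replicate (suc k) true)
  only-replicate w = mk⇔ proj₂ λ { refl → inB₁-replicate k , refl }

conj∘suffixWeights-injective : ∀ {l u v} → InB₁ l u → InB₁ l v → conj (suffixWeights u) ≡ conj (suffixWeights v) → u ≡ v
conj∘suffixWeights-injective {u = u} {v} (_ , _ , ends-u) (_ , _ , ends-v) eq = suffixWeights-injective (begin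
  suffixWeights u                     ≡⟨ sym (conj-involutive (isPartition-suffixWeights ends-u)) ⟩
  conj (conj (suffixWeights u))       ≡⟨ cong conj eq ⟩
  conj (conj (suffixWeights v))       ≡⟨ conj-involutive (isPartition-suffixWeights ends-v) ⟩
  suffixWeights v                     ∎)
  where open ≡-Reasoning

hasCard-inB : ∀ {k c} → HasCard (InB₁ (suc k)) c → HasCard (InB (suc k)) (c + c)
hasCard-inB B₁ = hasCard-⇔ (λ _ → ⇔.sym inB⇔)
  (hasCard-⊎ B₁ (hasCard-image (map not) (λ _ _ → map-not-injective) B₁) inB₁-¬complement)

hasCard-widthExactly : ∀ {k c} → HasCard (InB₁ (suc k)) c → HasCard (WidthExactly (suc k)) c
hasCard-widthExactly B₁ =
  hasCard-⇔ (λ _ → ⇔.sym widthExactly⇔) (hasCard-image (conj ∘ suffixWeights) conj∘suffixWeights-injective B₁)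

hasCard-new : ∀ {k c b} → HasCard (InB₁ (suc k)) c → HasCard (λ w → InB₁ (suc k) w × w ≢ replicate (suc k) true) b →
              HasCard (λ p → InΔ (suc k) (suc k) p × ¬ InΔ k k p) (c + b)
hasCard-new {k} B₁ B₁-¬replicate = hasCard-⇔ (λ _ → ⇔.sym new⇔) (hasCard-⊎
  (hasCard-⇔ (λ _ → ⇔.sym heightExactly⇔) (hasCard-image suffixWeights (λ _ _ → suffixWeights-injective) B₁))
  (hasCard-⇔ (λ _ → ⇔.sym widthExactly-heightBelow⇔)
    (hasCard-image (conj ∘ suffixWeights) (λ u v → conj∘suffixWeights-injective (proj₁ u) (proj₁ v)) B₁-¬replicate))
  λ (_ , _ , len≡ , _) (_ , len≤) → 1+n≰n (subst (_≤ k) len≡ len≤))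

hasCard-Δ-suc : ∀ {k i d} → HasCard (InΔ k k) i → HasCard (λ p → InΔ (suc k) (suc k) p × ¬ InΔ k k p) d →
                HasCard (InΔ (suc k) (suc k)) (i + d)
hasCard-Δ-suc Δₖ new = hasCard-⇔ (λ _ → ⇔.sym Δ-suc⇔) (hasCard-⊎ Δₖ new λ small (_ , ¬small) → ¬small small)

triangular-[] : Triangular []
triangular-[] = triangularℕ⇒triangular (1 , 1 , 1 , ≤-refl , ≤-refl , ≤-refl , λ
  { (suc a) (suc j) _ _ → mk⇔ (λ ()) λ { (s≤s below) → ⊥-elim (n≮0 (m+n≤o⇒n≤o (a * 1) below)) } })

hasCard-Δ : ∀ l → Σ ℕ λ n → HasCard (InΔ l l) n
hasCard-Δ zero    =
  1 , [] ∷ [] , [] ∷ [] , (λ p → mk⇔ (λ { (here refl) → empty }) λ (_ , _ , len≤0 , _) → here (length≤0 p len≤0)) , refl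
  where
  empty : InΔ 0 0 []
  empty = isPartition-staircase 0 , triangular-[] , z≤n , z≤n
  length≤0 : ∀ p → length p ≤ 0 → p ≡ []
  length≤0 [] _ = refl
hasCard-Δ (suc k) =
  let (i , Δₖ) = hasCard-Δ k
      (c , B₁) = hasCard-inB₁ (suc k)
      (b , B₁-¬replicate , _) = hasCard-inB₁-¬replicate B₁
  in i + (c + b) , hasCard-Δ-suc Δₖ (hasCard-new B₁ B₁-¬replicate)

lemma7p3 : ∀ (l : ℕ) → 1 ≤ l →
    Σ ℕ λ b → HasCard (InB l) b ×
      (Σ ℕ λ t → HasCard (λ (p : List ℕ) → IsPartition p × Triangular p × width p ≡ l × height p ≤ l) t
                 × 2 * t ≡ b) ×
      (Σ ℕ λ d → Σ ℕ λ i1 → Σ ℕ λ i0 →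
         HasCard (λ (p : List ℕ) → InΔ l l p × ¬ InΔ (l ∸ 1) (l ∸ 1) p) d ×
         HasCard (CountedByI (staircase l)) i1 ×
         HasCard (CountedByI (staircase (l ∸ 1))) i0 ×
         d + i0 ≡ i1 × d + 1 ≡ b)
lemma7p3 (suc k) _ =
  let (c , B₁) = hasCard-inB₁ (suc k)
      (b , B₁-¬replicate , 1+b≡c) = hasCard-inB₁-¬replicate B₁
      (i , Δₖ) = hasCard-Δ k
      new = hasCard-new B₁ B₁-¬replicate
  in c + c , hasCard-inB B₁ ,
     (c , hasCard-widthExactly B₁ , cong (c +_) (+-identityʳ c)) ,
     (c + b , i + (c + b) , i , new ,
      hasCard-⇔ (λ _ → ⇔.sym countedByI-staircase⇔) (hasCard-Δ-suc Δₖ new) ,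
      hasCard-⇔ (λ _ → ⇔.sym countedByI-staircase⇔) Δₖ ,
      +-comm (c + b) i ,
      trans (+-assoc c b 1) (cong (c +_) (trans (+-comm b 1) 1+b≡c)))
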